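{- Let $k$ be a positive integer. (a) For $n\ge1$, $\dim_{k,f}(P_n+K_1)=\dim_f(P_n+K_1)$, and this common value equals $\frac{n+1}{2}$ if $n\in\{1,2,3\}$; $\frac53$ if $n\in\{4,5\}$; $\frac{n+1}{4}$ if $n\ge 6$ and $n\equiv 1,3\pmod 4$; $\frac{n+2}{4}$ if $n\ge 6$ and $n\equiv 2\pmod 4$. (b) If $n\ge 8$ and $n\equiv 0\pmod 4$, then $\frac n4\le \dim_{k,f}(P_n+K_1)=\dim_f(P_n+K_1)\le\frac{n+2}{4}$.
   Context: All graphs are finite, simple, undirected and connected. $P_n$ is the path on $n$ vertices, $K_1$ a single vertex, and $G+H$ is the join (disjoint union plus all edges between $G$ and $H$). $d(x,y)$ denotes the distance. For $g$ defined on $V(G)$ and $U\subseteq V(G)$, $g(U)=\sum_{s\in U}g(s)$. For distinct $x,y$, $R\{x,y\}=\{z: d(x,z)\ne d(y,z)\}$; a function $g:V(G)\to[0,1]$ is a resolving function if $g(R\{x,y\})\ge1$ for all distinct $x,y$, and $\dim_f(G)$ is the minimum of $g(V(G))$ over resolving functions. For a positive integer $k$, $d_k(x,y)=\min\{d(x,y),k+1\}$, $R_k\{x,y\}=\{z\in V(G): d_k(x,z)\neq d_k(y,z)\}$; a function $h:V(G)\to[0,1]$ is a $k$-truncated resolving function if $h(R_k\{x,y\})\ge 1$ for all distinct $x,y$; $\dim_{k,f}(G)$ is the minimum of $h(V(G))$ over $k$-truncated resolving functions.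
   Formalization: The resolving functions and k-truncated resolving functions take rational values in [0,1] instead of real values. -}

module Defs where

open import Data.Nat as ℕ using (ℕ; zero; suc; _≡ᵇ_; _⊓_)
open import Data.Fin using (Fin; toℕ; zero; suc)
open import Data.Bool using (Bool; true; false; if_then_else_; _∧_; _∨_; not)
open import Data.Rational using (ℚ; 0ℚ; 1ℚ; _+_; _≤_)
open import Data.Product using (Σ; _×_)
open import Relation.Binary.PropositionalEquality using (_≡_; _≢_)

Graph : ℕ → Set
Graph m = Fin m → Fin m → Bool

_==_ : ∀ {m} → Fin m → Fin m → Bool
x == y = toℕ x ≡ᵇ toℕ y

anyFin : ∀ {m} → (Fin m → Bool) → Bool
anyFin {zero}  p = false
anyFin {suc m} p = p zero ∨ anyFin (λ i → p (suc i))

reach : ∀ {m} → Graph m → ℕ → Fin m → Fin m → Bool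
reach G zero    x y = x == y
reach G (suc j) x y = reach G j x y ∨ anyFin (λ z → G x z ∧ reach G j z y)

distSearch : ∀ {m} → Graph m → (fuel start : ℕ) → Fin m → Fin m → ℕ
distSearch G zero       start x y = start
distSearch G (suc fuel) start x y =
  if reach G start x y then start else distSearch G fuel (suc start) x y

-- Graph distance d(x,y): the least j such that a walk of length j from
-- x to y exists (for connected graphs on m vertices, j ≤ m - 1, so the
-- fuel m suffices).
dist : ∀ {m} → Graph m → Fin m → Fin m → ℕ
dist {m} G x y = distSearch G m 0 x y

distTrunc : ∀ {m} → ℕ → Graph m → Fin m → Fin m → ℕ
distTrunc k G x y = dist G x y ⊓ suc k

sumℚ : ∀ {m} → (Fin m → ℚ) → ℚ
sumℚ {zero}  f = 0ℚ
sumℚ {suc m} f = f zero + sumℚ (λ i → f (suc i))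

weight : ∀ {m} → (Fin m → ℚ) → (Fin m → Bool) → ℚ
weight g P = sumℚ (λ z → if P z then g z else 0ℚ)

inR : ∀ {m} → (Fin m → Fin m → ℕ) → Fin m → Fin m → Fin m → Bool
inR D x y z = not (D x z ≡ᵇ D y z)

IsResolvingFor : ∀ {m} → (Fin m → Fin m → ℕ) → (Fin m → ℚ) → Set
IsResolvingFor {m} D g =
  ((z : Fin m) → (0ℚ ≤ g z) × (g z ≤ 1ℚ)) ×
  ((x y : Fin m) → x ≢ y → 1ℚ ≤ weight g (inR D x y))

IsMinResolvingWeight : ∀ {m} → (Fin m → Fin m → ℕ) → ℚ → Set
IsMinResolvingWeight {m} D d =
  Σ (Fin m → ℚ) (λ g → IsResolvingFor D g × (sumℚ g ≡ d)) ×
  ((g : Fin m → ℚ) → IsResolvingFor D g → d ≤ sumℚ g)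

IsFracMetricDim : ∀ {m} → Graph m → ℚ → Set
IsFracMetricDim G d = IsMinResolvingWeight (dist G) d

IsTruncFracMetricDim : ∀ {m} → ℕ → Graph m → ℚ → Set
IsTruncFracMetricDim k G d = IsMinResolvingWeight (distTrunc k G) d

-- The fan graph P_n + K_1 on vertex set Fin (suc n):
-- vertices with toℕ i < n are the path vertices 0,1,…,n-1 (i ~ i+1),
-- the vertex with toℕ = n is the apex K_1, adjacent to all path vertices.

fan : (n : ℕ) → Graph (suc n)
fan n x y =
  if isApex x then not (isApex y)
  else (if isApex y then true
        else ((suc (toℕ x) ≡ᵇ toℕ y) ∨ (suc (toℕ y) ≡ᵇ toℕ x)))
  where
  isApex : Fin (suc n) → Bool
  isApex v = toℕ v ≡ᵇ n

-- In P_n + K_1 (n ≥ 1) every distance is at most 2, so for k ≥ 1 truncation changes nothing, and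
-- both dimensions are the optimum of one linear program: minimise Σ g over 0 ≤ g ≤ 1 subject to
-- g(R{x,y}) ≥ 1 for all x ≠ y. Each optimum is certified by a resolving function together with a
-- feasible solution of the dual program (nonnegative weights on pairs whose total at every vertex
-- is at most 1) of the same total, so that weak duality makes both optimal. On the path R{x,y} is
-- determined by the vertices within distance one of x and of y, so apart from the smallest fans
-- the certificates are periodic sequences of weights, checked window by window. For n = 4m the
-- optimum is 2m(m + 1)/(2m + 1), which lies between n/4 and (n + 2)/4.

module Submission where

open import Defs
open import Data.Nat using (ℕ; suc; _≤_; _%_)
open import Data.Integer using (+_)
open import Data.Rational using (ℚ; _/_) renaming (_≤_ to _≤ℚ_)
open import Data.Product using (Σ; _×_)
open import Data.Sum using (_⊎_)
open import Relation.Binary.PropositionalEquality using (_≡_)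

open import Algebra.Bundles using (CommutativeMonoid)
open import Data.Bool using (Bool; true; false; if_then_else_; _∧_; _∨_; not; T)
open import Data.Bool.ListAction using (all)
open import Data.Bool.Properties using (∨-zeroʳ; ∧-zeroʳ; ∧-identityʳ; T-∧; T-∨)
open import Data.Empty using (⊥-elim)
open import Data.Fin using (Fin; toℕ; fromℕ; fromℕ<) renaming (zero to fzero; suc to fsuc)
import Data.Fin.Properties as Fin
import Data.Integer as ℤ
import Data.Integer.Properties as ℤ
open import Data.Integer.Tactic.RingSolver using () renaming (solve-∀ to ℤ-solve-∀)
open import Data.List using (List; []; _∷_; _++_; map; applyUpTo; length)
import Data.List as List
open import Data.List.Properties using (map-++; length-++)
open import Data.List.Relation.Unary.All using (All; []; _∷_)
import Data.List.Relation.Unary.All as All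
import Data.List.Relation.Unary.All.Properties as All
open import Data.List.Relation.Unary.AllPairs using (AllPairs; []; _∷_)
import Data.List.Relation.Unary.AllPairs as AllPairs
open import Data.List.Relation.Unary.Linked using (Linked; []; [-]; _∷_)
open import Data.List.Relation.Unary.Linked.Properties using (Linked⇒AllPairs)
open import Data.Nat using (zero; _+_; _*_; _<_; s≤s; z≤n; pred; _≡ᵇ_; _≤ᵇ_; _<?_)
import Data.Nat as ℕ
open import Data.Nat.DivMod using (m≡m%n+[m/n]*n; [m+kn]%n≡m%n; m%n<n)
open import Data.Nat.ListAction using (sum)
open import Data.Nat.ListAction.Properties using (sum-++)
open import Data.Nat.Properties
open import Data.Nat.Tactic.RingSolver using (solve; solve-∀)
open import Data.Product using (_,_; proj₁; proj₂)
open import Data.Rational using (0ℚ; 1ℚ; toℚᵘ)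
import Data.Rational as ℚ
import Data.Rational.Properties as ℚₚ
open import Data.Rational.Unnormalised using (mkℚᵘ; *≡*; *≤*) renaming (_≃_ to _≃ᵘ_)
import Data.Rational.Unnormalised.Properties as ℚᵘ
open import Data.Sum using (inj₁; inj₂)
open import Data.Unit using (⊤; tt)
open import Function.Bundles using (Equivalence)
open import Relation.Binary using (tri<; tri≈; tri>)
open import Relation.Binary.PropositionalEquality
  using (refl; sym; trans; cong; cong₂; subst; subst₂; _≢_; ≢-sym; module ≡-Reasoning)
open import Relation.Nullary using (yes; no)

open import Algebra.Properties.CommutativeSemigroup
  (CommutativeMonoid.commutativeSemigroup ℚₚ.+-0-commutativeMonoid)
  using () renaming (interchange to ℚ-+-interchange)
open import Algebra.Properties.CommutativeSemigroup +-commutativeSemigroup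
  using () renaming (interchange to ℕ-+-interchange)

infix 8 _/1+_

-- Opaque, so that conversion checking never unfolds the normalisation of a rational.
opaque
  _/1+_ : ℕ → ℕ → ℚ
  a /1+ d = + a / suc d

opaque
  unfolding _/1+_

  /1+-def : ∀ a d → a /1+ d ≡ + a / suc d
  /1+-def a d = refl

  toℚᵘ-/1+ : ∀ a d → toℚᵘ (a /1+ d) ≃ᵘ mkℚᵘ (+ a) d
  toℚᵘ-/1+ a d = ℚₚ.toℚᵘ-fromℚᵘ (mkℚᵘ (+ a) d)

  /1+-zero : ∀ d → 0 /1+ d ≡ 0ℚ
  /1+-zero d = ℚₚ.0/n≡0 (suc d)

/1+-cross-≡ : ∀ a d b e → a * suc e ≡ b * suc d → a /1+ d ≡ b /1+ e
/1+-cross-≡ a d b e eq = ℚₚ.toℚᵘ-injective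
  (ℚᵘ.≃-trans (toℚᵘ-/1+ a d) (ℚᵘ.≃-trans (*≡* eqℤ) (ℚᵘ.≃-sym (toℚᵘ-/1+ b e))))
  where
  eqℤ : + a ℤ.* + suc e ≡ + b ℤ.* + suc d
  eqℤ = trans (sym (ℤ.pos-* a (suc e))) (trans (cong +_ eq) (ℤ.pos-* b (suc d)))

/1+-cross-≤ : ∀ a d b e → a * suc e ≤ b * suc d → a /1+ d ≤ℚ b /1+ e
/1+-cross-≤ a d b e le = ℚₚ.toℚᵘ-cancel-≤
  (ℚᵘ.≤-respʳ-≃ (ℚᵘ.≃-sym (toℚᵘ-/1+ b e)) (ℚᵘ.≤-respˡ-≃ (ℚᵘ.≃-sym (toℚᵘ-/1+ a d))
    (*≤* (subst₂ ℤ._≤_ (ℤ.pos-* a (suc e)) (ℤ.pos-* b (suc d)) (ℤ.+≤+ le)))))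

/1+-mono-≤ : ∀ {a b} d → a ≤ b → a /1+ d ≤ℚ b /1+ d
/1+-mono-≤ {a} {b} d le = /1+-cross-≤ a d b d (*-monoˡ-≤ (suc d) le)

/1+-self : ∀ d → suc d /1+ d ≡ 1ℚ
/1+-self d = trans (/1+-cross-≡ (suc d) d 1 0 (trans (*-identityʳ (suc d)) (sym (*-identityˡ (suc d))))) (/1+-def 1 0)

/1+-nonNeg : ∀ a d → 0ℚ ≤ℚ a /1+ d
/1+-nonNeg a d = subst (_≤ℚ a /1+ d) (/1+-zero d) (/1+-mono-≤ {0} {a} d z≤n)

/1+-+ : ∀ a b d → a /1+ d ℚ.+ b /1+ d ≡ (a + b) /1+ d
/1+-+ a b d = ℚₚ.toℚᵘ-injective (ℚᵘ.≃-trans (ℚₚ.toℚᵘ-homo-+ (a /1+ d) (b /1+ d))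
  (ℚᵘ.≃-trans (ℚᵘ.+-cong (toℚᵘ-/1+ a d) (toℚᵘ-/1+ b d))
  (ℚᵘ.≃-trans (*≡* eqℤ) (ℚᵘ.≃-sym (toℚᵘ-/1+ (a + b) d)))))
  where
  distrib : ∀ (x y z : ℤ.ℤ) → (x ℤ.* z ℤ.+ y ℤ.* z) ℤ.* z ≡ (x ℤ.+ y) ℤ.* (z ℤ.* z)
  distrib = ℤ-solve-∀
  eqℤ : (+ a ℤ.* + suc d ℤ.+ + b ℤ.* + suc d) ℤ.* + suc d ≡ + (a + b) ℤ.* (+ suc d ℤ.* + suc d)
  eqℤ = trans (distrib (+ a) (+ b) (+ suc d)) (cong (ℤ._* (+ suc d ℤ.* + suc d)) (sym (ℤ.pos-+ a b)))

≡ᵇ-refl : ∀ a → (a ≡ᵇ a) ≡ true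
≡ᵇ-refl zero    = refl
≡ᵇ-refl (suc a) = ≡ᵇ-refl a

≡ᵇ-true⇒≡ : ∀ a b → (a ≡ᵇ b) ≡ true → a ≡ b
≡ᵇ-true⇒≡ a b e = ≡ᵇ⇒≡ a b (subst T (sym e) _)

≡⇒≡ᵇ-true : ∀ {a b} → a ≡ b → (a ≡ᵇ b) ≡ true
≡⇒≡ᵇ-true {a} refl = ≡ᵇ-refl a

≢⇒≡ᵇ-false : ∀ {a b} → a ≢ b → (a ≡ᵇ b) ≡ false
≢⇒≡ᵇ-false {a} {b} a≢b with a ≡ᵇ b in e
... | true  = ⊥-elim (a≢b (≡ᵇ-true⇒≡ a b e))
... | false = refl

≡ᵇ-sym : ∀ a b → (a ≡ᵇ b) ≡ (b ≡ᵇ a)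
≡ᵇ-sym zero    zero    = refl
≡ᵇ-sym zero    (suc b) = refl
≡ᵇ-sym (suc a) zero    = refl
≡ᵇ-sym (suc a) (suc b) = ≡ᵇ-sym a b

anyFin-witness : ∀ {m} (p : Fin m → Bool) i → p i ≡ true → anyFin p ≡ true
anyFin-witness p fzero    e rewrite e = refl
anyFin-witness p (fsuc i) e = trans (cong (p fzero ∨_) (anyFin-witness (λ j → p (fsuc j)) i e)) (∨-zeroʳ (p fzero))

anyFin-none : ∀ {m} (p : Fin m → Bool) → (∀ i → p i ≡ false) → anyFin p ≡ false
anyFin-none {zero}  p none = refl
anyFin-none {suc m} p none rewrite none fzero = anyFin-none (λ j → p (fsuc j)) (λ j → none (fsuc j))

anyFin-∧-== : ∀ {m} (q : Fin m → Bool) y → anyFin (λ z → q z ∧ (z == y)) ≡ q y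
anyFin-∧-== q y with q y in qy
... | true  = anyFin-witness _ y (cong₂ _∧_ qy (≡ᵇ-refl (toℕ y)))
... | false = anyFin-none _ off
  where
  off : ∀ z → (q z ∧ (z == y)) ≡ false
  off z with toℕ z ≡ᵇ toℕ y in zy
  ... | false = ∧-zeroʳ (q z)
  ... | true  = trans (∧-identityʳ (q z))
                      (subst (λ w → q w ≡ false) (sym (Fin.toℕ-injective (≡ᵇ-true⇒≡ (toℕ z) (toℕ y) zy))) qy)

reach-1 : ∀ {m} (G : Graph m) x y → reach G 1 x y ≡ ((x == y) ∨ G x y)
reach-1 G x y = cong ((x == y) ∨_) (anyFin-∧-== (G x) y)

reach-refl : ∀ {m} (G : Graph m) j x y → (x == y) ≡ true → reach G j x y ≡ true
reach-refl G zero    x y e = e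
reach-refl G (suc j) x y e rewrite reach-refl G j x y e = refl

reach-step : ∀ {m} (G : Graph m) j x z y → G x z ≡ true → reach G j z y ≡ true → reach G (suc j) x y ≡ true
reach-step G j x z y xz zy =
  trans (cong (reach G j x y ∨_) (anyFin-witness _ z (cong₂ _∧_ xz zy))) (∨-zeroʳ (reach G j x y))

reach-adjacent : ∀ {m} (G : Graph m) j x y → G x y ≡ true → reach G (suc j) x y ≡ true
reach-adjacent G j x y xy = reach-step G j x y y xy (reach-refl G j y y (≡ᵇ-refl (toℕ y)))

fanAdj : ℕ → ℕ → ℕ → Bool
fanAdj n a b =
  if a ≡ᵇ n then not (b ≡ᵇ n)
  else (if b ≡ᵇ n then true else ((suc a ≡ᵇ b) ∨ (suc b ≡ᵇ a)))

fanDist : ℕ → ℕ → ℕ → ℕ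
fanDist n a b = if a ≡ᵇ b then 0 else (if fanAdj n a b then 1 else 2)

fanAdj-apexˡ : ∀ n a b → (a ≡ᵇ n) ≡ true → (b ≡ᵇ n) ≡ false → fanAdj n a b ≡ true
fanAdj-apexˡ n a b a≡n b≢n rewrite a≡n | b≢n = refl

fanAdj-apexʳ : ∀ n a b → (a ≡ᵇ n) ≡ false → (b ≡ᵇ n) ≡ true → fanAdj n a b ≡ true
fanAdj-apexʳ n a b a≢n b≡n rewrite a≢n | b≡n = refl

fan-reach-2 : ∀ n (x y : Fin (suc n)) → reach (fan n) 2 x y ≡ true
fan-reach-2 n x y = by-apex (toℕ x ≡ᵇ n) (toℕ y ≡ᵇ n) refl refl
  where
  apex≡n : (toℕ (fromℕ n) ≡ᵇ n) ≡ true
  apex≡n = ≡⇒≡ᵇ-true (Fin.toℕ-fromℕ n)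
  by-apex : ∀ bx by → (toℕ x ≡ᵇ n) ≡ bx → (toℕ y ≡ᵇ n) ≡ by → reach (fan n) 2 x y ≡ true
  by-apex true  true  x≡n y≡n =
    reach-refl (fan n) 2 x y (≡⇒≡ᵇ-true (trans (≡ᵇ-true⇒≡ (toℕ x) n x≡n) (sym (≡ᵇ-true⇒≡ (toℕ y) n y≡n))))
  by-apex true  false x≡n y≢n = reach-adjacent (fan n) 1 x y (fanAdj-apexˡ n (toℕ x) (toℕ y) x≡n y≢n)
  by-apex false true  x≢n y≡n = reach-adjacent (fan n) 1 x y (fanAdj-apexʳ n (toℕ x) (toℕ y) x≢n y≡n)
  by-apex false false x≢n y≢n = reach-step (fan n) 1 x (fromℕ n) y
    (fanAdj-apexʳ n (toℕ x) (toℕ (fromℕ n)) x≢n apex≡n)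
    (reach-adjacent (fan n) 0 (fromℕ n) y (fanAdj-apexˡ n (toℕ (fromℕ n)) (toℕ y) apex≡n y≢n))

dist-fan : ∀ n → 1 ≤ n → (x y : Fin (suc n)) → dist (fan n) x y ≡ fanDist n (toℕ x) (toℕ y)
dist-fan (suc n) _ x y = trans
  (cong₂ (λ r t → if x == y then 0 else (if r then 1 else t)) (reach-1 G x y) (search-from-2 n))
  (else-branch-drops (x == y) (G x y))
  where
  G : Graph (suc (suc n))
  G = fan (suc n)
  search-from-2 : ∀ fuel → distSearch G fuel 2 x y ≡ 2
  search-from-2 zero       = refl
  search-from-2 (suc fuel) = cong (λ r → if r then 2 else distSearch G fuel 3 x y) (fan-reach-2 (suc n) x y)
  else-branch-drops : ∀ u v → (if u then 0 else (if u ∨ v then 1 else 2)) ≡ (if u then 0 else (if v then 1 else 2))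
  else-branch-drops true  v = refl
  else-branch-drops false v = refl

fanDist≤2 : ∀ n a b → fanDist n a b ≤ 2
fanDist≤2 n a b with a ≡ᵇ b
... | true  = z≤n
... | false with fanAdj n a b
...   | true  = s≤s z≤n
...   | false = ≤-refl

distTrunc-fan : ∀ k n → 1 ≤ k → 1 ≤ n → (x y : Fin (suc n)) →
  distTrunc k (fan n) x y ≡ fanDist n (toℕ x) (toℕ y)
distTrunc-fan k n 1≤k 1≤n x y rewrite dist-fan n 1≤n x y =
  m≤n⇒m⊓n≡m (≤-trans (fanDist≤2 n (toℕ x) (toℕ y)) (s≤s 1≤k))

sumBelow : ℕ → (ℕ → ℕ) → ℕ
sumBelow zero    F = 0
sumBelow (suc N) F = F 0 + sumBelow N (λ i → F (suc i))

ind : Bool → ℕ → ℕ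
ind b c = if b then c else 0

sumℚ-cong : ∀ {m} {f h : Fin m → ℚ} → (∀ z → f z ≡ h z) → sumℚ f ≡ sumℚ h
sumℚ-cong {zero}  eq = refl
sumℚ-cong {suc m} eq = cong₂ ℚ._+_ (eq fzero) (sumℚ-cong (λ i → eq (fsuc i)))

sumℚ-mono-≤ : ∀ {m} {f h : Fin m → ℚ} → (∀ z → f z ≤ℚ h z) → sumℚ f ≤ℚ sumℚ h
sumℚ-mono-≤ {zero}  le = ℚₚ.≤-refl
sumℚ-mono-≤ {suc m} le = ℚₚ.+-mono-≤ (le fzero) (sumℚ-mono-≤ (λ i → le (fsuc i)))

sumℚ-zero : ∀ m → sumℚ {m} (λ _ → 0ℚ) ≡ 0ℚ
sumℚ-zero zero    = refl
sumℚ-zero (suc m) = cong (0ℚ ℚ.+_) (sumℚ-zero m)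

sumℚ-+ : ∀ {m} (f h : Fin m → ℚ) → sumℚ (λ z → f z ℚ.+ h z) ≡ sumℚ f ℚ.+ sumℚ h
sumℚ-+ {zero}  f h = refl
sumℚ-+ {suc m} f h =
  trans (cong (f fzero ℚ.+ h fzero ℚ.+_) (sumℚ-+ (λ i → f (fsuc i)) (λ i → h (fsuc i))))
        (ℚ-+-interchange (f fzero) (h fzero) _ _)

sumℚ-*ˡ : ∀ {m} c (f : Fin m → ℚ) → sumℚ (λ z → c ℚ.* f z) ≡ c ℚ.* sumℚ f
sumℚ-*ˡ {zero}  c f = sym (ℚₚ.*-zeroʳ c)
sumℚ-*ˡ {suc m} c f =
  trans (cong (c ℚ.* f fzero ℚ.+_) (sumℚ-*ˡ c (λ i → f (fsuc i)))) (sym (ℚₚ.*-distribˡ-+ c (f fzero) _))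

sumℚ-/1+ : ∀ m d (F : ℕ → ℕ) → sumℚ {m} (λ z → F (toℕ z) /1+ d) ≡ sumBelow m F /1+ d
sumℚ-/1+ zero    d F = sym (/1+-zero d)
sumℚ-/1+ (suc m) d F = trans (cong (F 0 /1+ d ℚ.+_) (sumℚ-/1+ m d (λ i → F (suc i)))) (/1+-+ (F 0) _ d)

if-/1+ : ∀ b c d → (if b then c /1+ d else 0ℚ) ≡ ind b c /1+ d
if-/1+ true  c d = refl
if-/1+ false c d = sym (/1+-zero d)

weight-/1+ : ∀ m d (F : ℕ → ℕ) (P : ℕ → Bool) →
  weight {m} (λ z → F (toℕ z) /1+ d) (λ z → P (toℕ z)) ≡ sumBelow m (λ z → ind (P z) (F z)) /1+ d
weight-/1+ m d F P =
  trans (sumℚ-cong {m} (λ z → if-/1+ (P (toℕ z)) (F (toℕ z)) d)) (sumℚ-/1+ m d (λ z → ind (P z) (F z)))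

toℕ≤ : ∀ {n} (x : Fin (suc n)) → toℕ x ≤ n
toℕ≤ x = ≤-pred (Fin.toℕ<n x)

sumBelow-cong : ∀ N {F H : ℕ → ℕ} → (∀ z → F z ≡ H z) → sumBelow N F ≡ sumBelow N H
sumBelow-cong zero    eq = refl
sumBelow-cong (suc N) eq = cong₂ _+_ (eq 0) (sumBelow-cong N (λ z → eq (suc z)))

sumBelow-mono-≤ : ∀ N {F H : ℕ → ℕ} → (∀ z → z < N → F z ≤ H z) → sumBelow N F ≤ sumBelow N H
sumBelow-mono-≤ zero    le = z≤n
sumBelow-mono-≤ (suc N) le = +-mono-≤ (le 0 (s≤s z≤n)) (sumBelow-mono-≤ N (λ z z<N → le (suc z) (s≤s z<N)))

sumBelow-+ : ∀ N (F H : ℕ → ℕ) → sumBelow N (λ z → F z + H z) ≡ sumBelow N F + sumBelow N H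
sumBelow-+ zero    F H = refl
sumBelow-+ (suc N) F H =
  trans (cong (λ t → F 0 + H 0 + t) (sumBelow-+ N (λ z → F (suc z)) (λ z → H (suc z))))
        (ℕ-+-interchange (F 0) (H 0) _ _)

sumBelow-zero : ∀ N → sumBelow N (λ _ → 0) ≡ 0
sumBelow-zero zero    = refl
sumBelow-zero (suc N) = sumBelow-zero N

sumBelow-last : ∀ N (F : ℕ → ℕ) → sumBelow (suc N) F ≡ sumBelow N F + F N
sumBelow-last zero    F = +-comm (F 0) 0
sumBelow-last (suc N) F = trans (cong (λ t → F 0 + t) (sumBelow-last N (λ z → F (suc z)))) (sym (+-assoc (F 0) _ _))

sumBelow-at : ∀ N u (F : ℕ → ℕ) → sumBelow N (λ z → ind (z ≡ᵇ u) (F z)) ≤ F u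
sumBelow-at zero    u       F = z≤n
sumBelow-at (suc N) zero    F = ≤-reflexive (trans (cong (λ t → F 0 + t) (sumBelow-zero N)) (+-identityʳ (F 0)))
sumBelow-at (suc N) (suc u) F = sumBelow-at N u (λ z → F (suc z))

sumBelow-at-pred : ∀ N u (F : ℕ → ℕ) → sumBelow N (λ z → ind (suc z ≡ᵇ u) (F z)) ≤ F (pred u)
sumBelow-at-pred N zero    F = ≤-trans (≤-reflexive (sumBelow-zero N)) z≤n
sumBelow-at-pred N (suc u) F = sumBelow-at N u F

zeroAt : ℕ → (ℕ → ℕ) → ℕ → ℕ
zeroAt u H z = if z ≡ᵇ u then 0 else H z

sumBelow-zeroAt : ∀ N H u → u < N → sumBelow N H ≡ H u + sumBelow N (zeroAt u H)
sumBelow-zeroAt (suc N) H zero    _         = refl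
sumBelow-zeroAt (suc N) H (suc u) (s≤s u<N) = begin
  H 0 + sumBelow N (λ z → H (suc z))
    ≡⟨ cong (λ t → H 0 + t) (sumBelow-zeroAt N (λ z → H (suc z)) u u<N) ⟩
  H 0 + (H (suc u) + rest)   ≡⟨ +-assoc (H 0) (H (suc u)) rest ⟨
  H 0 + H (suc u) + rest     ≡⟨ cong (_+ rest) (+-comm (H 0) (H (suc u))) ⟩
  H (suc u) + H 0 + rest     ≡⟨ +-assoc (H (suc u)) (H 0) rest ⟩
  H (suc u) + (H 0 + rest)   ∎
  where
  open ≡-Reasoning
  rest : ℕ
  rest = sumBelow N (zeroAt u (λ z → H (suc z)))

CountedIn : ℕ → (ℕ → ℕ) → (ℕ → ℕ) → ℕ → Set
CountedIn N H G u = (u < N × H u ≡ G u) ⊎ G u ≡ 0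

sum-distinct≤sumBelow : ∀ N H G us → AllPairs _≢_ us → All (CountedIn N H G) us → sum (map G us) ≤ sumBelow N H
sum-distinct≤sumBelow N H G []       _                  []                     = z≤n
sum-distinct≤sumBelow N H G (u ∷ us) (_ ∷ distinct)    (inj₂ Gu≡0 ∷ counted) rewrite Gu≡0 =
  sum-distinct≤sumBelow N H G us distinct counted
sum-distinct≤sumBelow N H G (u ∷ us) (u∉us ∷ distinct) (inj₁ (u<N , Hu≡Gu) ∷ counted)
  rewrite sumBelow-zeroAt N H u u<N | Hu≡Gu =
  +-monoʳ-≤ (G u) (sum-distinct≤sumBelow N (zeroAt u H) G us distinct (still-counted u∉us counted))
  where
  still-counted : ∀ {vs} → All (u ≢_) vs → All (CountedIn N H G) vs → All (CountedIn N (zeroAt u H) G) vs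
  still-counted []            []                          = []
  still-counted (_ ∷ u∉vs)    (inj₂ Gv≡0 ∷ counted)       = inj₂ Gv≡0 ∷ still-counted u∉vs counted
  still-counted {v ∷ _} (u≢v ∷ u∉vs) (inj₁ (v<N , Hv≡Gv) ∷ counted) =
    inj₁ (v<N , trans (cong (λ b → if b then 0 else H v) (≢⇒≡ᵇ-false (≢-sym u≢v))) Hv≡Gv) ∷ still-counted u∉vs counted

sorted⇒distinct : ∀ {us} → Linked _<_ us → AllPairs _≢_ us
sorted⇒distinct sorted = AllPairs.map <⇒≢ (Linked⇒AllPairs <-trans sorted)

back : ℕ → (ℕ → ℕ) → ℕ → ℕ
back zero    G z       = G z
back (suc s) G zero    = 0
back (suc s) G (suc z) = back s G z


sumBelow-at-back : ∀ K s (C : ℕ → ℕ) z → sumBelow K (λ a → ind (z ≡ᵇ s + a) (C a)) ≤ back s C z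
sumBelow-at-back K zero    C z       =
  ≤-trans (≤-reflexive (sumBelow-cong K (λ a → cong (λ r → ind r (C a)) (≡ᵇ-sym z a)))) (sumBelow-at K z C)
sumBelow-at-back K (suc s) C zero    = ≤-reflexive (sumBelow-zero K)
sumBelow-at-back K (suc s) C (suc z) = sumBelow-at-back K s C z

ind-∨₄ : ∀ p q r s c → ind (p ∨ q ∨ r ∨ s) c ≤ ind p c + ind q c + ind r c + ind s c
ind-∨₄ true  q     r     s     c =
  ≤-trans (m≤m+n c _) (≤-reflexive (sym (trans (+-assoc (c + ind q c) _ _) (+-assoc c _ _))))
ind-∨₄ false true  r     s     c = ≤-trans (m≤m+n c _) (≤-reflexive (sym (+-assoc c _ _)))
ind-∨₄ false false true  s     c = m≤m+n c _
ind-∨₄ false false false true  c = ≤-refl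
ind-∨₄ false false false false c = z≤n

ind-zero : ∀ b → ind b 0 ≡ 0
ind-zero true  = refl
ind-zero false = refl

sumBelow-+₄ : ∀ K (f g h k : ℕ → ℕ) →
  sumBelow K (λ a → f a + g a + h a + k a) ≡ sumBelow K f + sumBelow K g + sumBelow K h + sumBelow K k
sumBelow-+₄ K f g h k
  rewrite sumBelow-+ K (λ a → f a + g a + h a) k | sumBelow-+ K (λ a → f a + g a) h | sumBelow-+ K f g = refl

sumBelow-at-back₄ : ∀ K (C : ℕ → ℕ) x₁ s₁ x₂ s₂ x₃ s₃ x₄ s₄ →
  sumBelow K (λ a → ind ((x₁ ≡ᵇ s₁ + a) ∨ (x₂ ≡ᵇ s₂ + a) ∨ (x₃ ≡ᵇ s₃ + a) ∨ (x₄ ≡ᵇ s₄ + a)) (C a))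
  ≤ back s₁ C x₁ + back s₂ C x₂ + back s₃ C x₃ + back s₄ C x₄
sumBelow-at-back₄ K C x₁ s₁ x₂ s₂ x₃ s₃ x₄ s₄ = begin
  sumBelow K (λ a → ind ((x₁ ≡ᵇ s₁ + a) ∨ (x₂ ≡ᵇ s₂ + a) ∨ (x₃ ≡ᵇ s₃ + a) ∨ (x₄ ≡ᵇ s₄ + a)) (C a))
    ≤⟨ sumBelow-mono-≤ K (λ a _ → ind-∨₄ (x₁ ≡ᵇ s₁ + a) (x₂ ≡ᵇ s₂ + a) (x₃ ≡ᵇ s₃ + a) (x₄ ≡ᵇ s₄ + a) (C a)) ⟩
  sumBelow K (λ a → at x₁ s₁ a + at x₂ s₂ a + at x₃ s₃ a + at x₄ s₄ a)
    ≡⟨ sumBelow-+₄ K (at x₁ s₁) (at x₂ s₂) (at x₃ s₃) (at x₄ s₄) ⟩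
  sumBelow K (at x₁ s₁) + sumBelow K (at x₂ s₂) + sumBelow K (at x₃ s₃) + sumBelow K (at x₄ s₄)
    ≤⟨ +-mono-≤ (+-mono-≤ (+-mono-≤ (sumBelow-at-back K s₁ C x₁) (sumBelow-at-back K s₂ C x₂))
                          (sumBelow-at-back K s₃ C x₃)) (sumBelow-at-back K s₄ C x₄) ⟩
  back s₁ C x₁ + back s₂ C x₂ + back s₃ C x₃ + back s₄ C x₄ ∎
  where
  open ≤-Reasoning
  at : ℕ → ℕ → ℕ → ℕ
  at x s a = ind (x ≡ᵇ s + a) (C a)

record WeightedPair : Set where
  constructor wpair
  field
    pairWeight left right : ℕ

open WeightedPair

totalWeight : List WeightedPair → ℕ
totalWeight L = sum (map pairWeight L)

coverage : (ℕ → ℕ → ℕ → Bool) → List WeightedPair → ℕ → ℕ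
coverage Res L z = sum (map (λ p → ind (Res (left p) (right p) z) (pairWeight p)) L)

-- Res a b z says that vertex z resolves a and b. Scaled by 1 / (1 + d), G is a resolving function,
-- and L is a feasible solution of the dual linear program, in which pair p has weight pairWeight p.
IsPrimalCertificate : (ℕ → ℕ → ℕ → Bool) → ℕ → ℕ → (ℕ → ℕ) → Set
IsPrimalCertificate Res n d G =
  (∀ z → z ≤ n → G z ≤ suc d) ×
  (∀ a b → a ≤ n → b ≤ n → a ≢ b → suc d ≤ sumBelow (suc n) (λ z → ind (Res a b z) (G z)))

IsValidPair : ℕ → WeightedPair → Set
IsValidPair n p = left p ≤ n × right p ≤ n × left p ≢ right p

IsDualCertificate : (ℕ → ℕ → ℕ → Bool) → ℕ → ℕ → List WeightedPair → Set
IsDualCertificate Res n d L =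
  All (IsValidPair n) L ×
  (∀ z → z ≤ n → coverage Res L z ≤ suc d)

module Duality {n : ℕ} (D : Fin (suc n) → Fin (suc n) → ℕ) (Res : ℕ → ℕ → ℕ → Bool)
  (inR≡Res : ∀ x y z → inR D x y z ≡ Res (toℕ x) (toℕ y) (toℕ z)) where

  primal-resolving : ∀ d G → IsPrimalCertificate Res n d G → IsResolvingFor D (λ z → G (toℕ z) /1+ d)
  primal-resolving d G (G≤1+d , resolves) = bounds , resolving
    where
    bounds : ∀ z → (0ℚ ≤ℚ G (toℕ z) /1+ d) × (G (toℕ z) /1+ d ≤ℚ 1ℚ)
    bounds z = /1+-nonNeg (G (toℕ z)) d ,
               subst (G (toℕ z) /1+ d ≤ℚ_) (/1+-self d) (/1+-mono-≤ d (G≤1+d (toℕ z) (toℕ≤ z)))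
    resolving : ∀ x y → x ≢ y → 1ℚ ≤ℚ weight (λ z → G (toℕ z) /1+ d) (inR D x y)
    resolving x y x≢y = subst₂ _≤ℚ_ (/1+-self d)
      (sym (trans (sumℚ-cong (λ z → cong (λ r → if r then G (toℕ z) /1+ d else 0ℚ) (inR≡Res x y z)))
                  (weight-/1+ (suc n) d G (Res (toℕ x) (toℕ y)))))
      (/1+-mono-≤ d (resolves (toℕ x) (toℕ y) (toℕ≤ x) (toℕ≤ y) (λ e → x≢y (Fin.toℕ-injective e))))

  -- Weak duality: Σ_p w_p ≤ Σ_p w_p · g(R_p) = Σ_z coverage(z) · g(z) ≤ (1 + d) · Σ_z g(z).
  module WeakDuality (d : ℕ) (g : Fin (suc n) → ℚ) (g-resolving : IsResolvingFor D g) where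

    resolved : ℕ → ℕ → Fin (suc n) → Bool
    resolved a b z = Res a b (toℕ z)

    resolved-weight≥1 : ∀ a b → a ≤ n → b ≤ n → a ≢ b → 1ℚ ≤ℚ weight g (resolved a b)
    resolved-weight≥1 a b a≤n b≤n a≢b =
      subst (1ℚ ≤ℚ_) (sumℚ-cong (λ z → cong (λ r → if r then g z else 0ℚ) (trans (inR≡Res x y z) index-eq)))
        (proj₂ g-resolving x y (λ x≡y → a≢b (trans (sym toℕ-x) (trans (cong toℕ x≡y) toℕ-y))))
      where
      x y : Fin (suc n)
      x = fromℕ< (s≤s a≤n)
      y = fromℕ< (s≤s b≤n)
      toℕ-x : toℕ x ≡ a
      toℕ-x = Fin.toℕ-fromℕ< (s≤s a≤n)
      toℕ-y : toℕ y ≡ b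
      toℕ-y = Fin.toℕ-fromℕ< (s≤s b≤n)
      index-eq : ∀ {z} → Res (toℕ x) (toℕ y) z ≡ Res a b z
      index-eq {z} = cong₂ (λ u v → Res u v z) toℕ-x toℕ-y

    pairSum : List WeightedPair → ℚ
    pairSum []      = 0ℚ
    pairSum (p ∷ L) = pairWeight p /1+ d ℚ.* weight g (resolved (left p) (right p)) ℚ.+ pairSum L

    totalWeight≤pairSum : ∀ L → All (IsValidPair n) L →
      totalWeight L /1+ d ≤ℚ pairSum L
    totalWeight≤pairSum []      []  = ℚₚ.≤-reflexive (/1+-zero d)
    totalWeight≤pairSum (wpair c a b ∷ L) ((a≤n , b≤n , a≢b) ∷ valid) =
      subst (_≤ℚ pairSum (wpair c a b ∷ L)) (/1+-+ c (totalWeight L) d)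
        (ℚₚ.+-mono-≤ c≤c·weight (totalWeight≤pairSum L valid))
      where
      instance _ = ℚ.nonNegative (/1+-nonNeg c d)
      c≤c·weight : c /1+ d ≤ℚ c /1+ d ℚ.* weight g (resolved a b)
      c≤c·weight = subst (_≤ℚ c /1+ d ℚ.* weight g (resolved a b)) (ℚₚ.*-identityʳ (c /1+ d))
        (ℚₚ.*-monoˡ-≤-nonNeg (c /1+ d) (resolved-weight≥1 a b a≤n b≤n a≢b))

    ind-/1+-* : ∀ b c x → c /1+ d ℚ.* (if b then x else 0ℚ) ≡ ind b c /1+ d ℚ.* x
    ind-/1+-* true  c x = refl
    ind-/1+-* false c x = begin
      c /1+ d ℚ.* 0ℚ ≡⟨ ℚₚ.*-zeroʳ (c /1+ d) ⟩
      0ℚ             ≡⟨ ℚₚ.*-zeroˡ x ⟨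
      0ℚ ℚ.* x       ≡⟨ cong (ℚ._* x) (/1+-zero d) ⟨
      0 /1+ d ℚ.* x  ∎
      where open ≡-Reasoning

    pairSum-by-vertex : ∀ L → pairSum L ≡ sumℚ (λ z → coverage Res L (toℕ z) /1+ d ℚ.* g z)
    pairSum-by-vertex [] = begin
      0ℚ                           ≡⟨ sumℚ-zero (suc n) ⟨
      sumℚ {suc n} (λ _ → 0ℚ)      ≡⟨ sumℚ-cong {suc n} (λ z → trans (cong (ℚ._* g z) (/1+-zero d)) (ℚₚ.*-zeroˡ (g z))) ⟨
      sumℚ (λ z → 0 /1+ d ℚ.* g z) ∎
      where open ≡-Reasoning
    pairSum-by-vertex (wpair c a b ∷ L) = begin
      c /1+ d ℚ.* weight g (resolved a b) ℚ.+ pairSum L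
        ≡⟨ cong₂ ℚ._+_ (sumℚ-*ˡ (c /1+ d) (λ z → if resolved a b z then g z else 0ℚ)) (sym (pairSum-by-vertex L)) ⟨
      sumℚ (λ z → c /1+ d ℚ.* (if resolved a b z then g z else 0ℚ)) ℚ.+ sumℚ (λ z → cov L z /1+ d ℚ.* g z)
        ≡⟨ sumℚ-+ (λ z → c /1+ d ℚ.* (if resolved a b z then g z else 0ℚ)) (λ z → cov L z /1+ d ℚ.* g z) ⟨
      sumℚ (λ z → c /1+ d ℚ.* (if resolved a b z then g z else 0ℚ) ℚ.+ cov L z /1+ d ℚ.* g z)
        ≡⟨ sumℚ-cong vertex ⟩
      sumℚ (λ z → cov (wpair c a b ∷ L) z /1+ d ℚ.* g z) ∎
      where
      open ≡-Reasoning
      cov : List WeightedPair → Fin (suc n) → ℕ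
      cov L z = coverage Res L (toℕ z)
      vertex : ∀ z → c /1+ d ℚ.* (if resolved a b z then g z else 0ℚ) ℚ.+ cov L z /1+ d ℚ.* g z
                     ≡ cov (wpair c a b ∷ L) z /1+ d ℚ.* g z
      vertex z = begin
        c /1+ d ℚ.* (if resolved a b z then g z else 0ℚ) ℚ.+ cov L z /1+ d ℚ.* g z
          ≡⟨ cong (ℚ._+ cov L z /1+ d ℚ.* g z) (ind-/1+-* (resolved a b z) c (g z)) ⟩
        ind (resolved a b z) c /1+ d ℚ.* g z ℚ.+ cov L z /1+ d ℚ.* g z
          ≡⟨ ℚₚ.*-distribʳ-+ (g z) (ind (resolved a b z) c /1+ d) (cov L z /1+ d) ⟨
        (ind (resolved a b z) c /1+ d ℚ.+ cov L z /1+ d) ℚ.* g z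
          ≡⟨ cong (ℚ._* g z) (/1+-+ (ind (resolved a b z) c) (cov L z) d) ⟩
        cov (wpair c a b ∷ L) z /1+ d ℚ.* g z ∎

    lower-bound : ∀ L → IsDualCertificate Res n d L → totalWeight L /1+ d ≤ℚ sumℚ g
    lower-bound L (valid , covered) = ℚₚ.≤-trans (totalWeight≤pairSum L valid)
      (subst (_≤ℚ sumℚ g) (sym (pairSum-by-vertex L)) (sumℚ-mono-≤ scaled≤))
      where
      scaled≤ : ∀ z → coverage Res L (toℕ z) /1+ d ℚ.* g z ≤ℚ g z
      scaled≤ z = ℚₚ.≤-trans
        (ℚₚ.*-monoʳ-≤-nonNeg (g z) {{ℚ.nonNegative (proj₁ (proj₁ g-resolving z))}}
          (/1+-mono-≤ d (covered (toℕ z) (toℕ≤ z))))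
        (ℚₚ.≤-reflexive (trans (cong (ℚ._* g z) (/1+-self d)) (ℚₚ.*-identityˡ (g z))))

  certified-minimum : ∀ d G L → IsPrimalCertificate Res n d G → IsDualCertificate Res n d L →
    sumBelow (suc n) G ≡ totalWeight L → IsMinResolvingWeight D (totalWeight L /1+ d)
  certified-minimum d G L primal dual sums =
    ((λ z → G (toℕ z) /1+ d) , primal-resolving d G primal , trans (sumℚ-/1+ (suc n) d G) (cong (_/1+ d) sums)) ,
    (λ g g-resolving → WeakDuality.lower-bound d g g-resolving L dual)

fanRes : ℕ → ℕ → ℕ → ℕ → Bool
fanRes n a b z = not (fanDist n a z ≡ᵇ fanDist n b z)

-- Opaque, so that comparing two of these types never unfolds the distance search of the fan.
opaque
  HasFracDims : ℕ → ℕ → ℚ → Set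
  HasFracDims k n v = IsTruncFracMetricDim k (fan n) v × IsFracMetricDim (fan n) v

opaque
  unfolding HasFracDims

  fan-certified-dims : ∀ k n d G L → 1 ≤ k → 1 ≤ n →
    IsPrimalCertificate (fanRes n) n d G → IsDualCertificate (fanRes n) n d L →
    sumBelow (suc n) G ≡ totalWeight L → HasFracDims k n (totalWeight L /1+ d)
  fan-certified-dims k n d G L 1≤k 1≤n primal dual sums =
    Duality.certified-minimum (distTrunc k (fan n)) (fanRes n) trunc-res d G L primal dual sums ,
    Duality.certified-minimum (dist (fan n)) (fanRes n) dist-res d G L primal dual sums
    where
    trunc-res : ∀ x y z → inR (distTrunc k (fan n)) x y z ≡ fanRes n (toℕ x) (toℕ y) (toℕ z)
    trunc-res x y z = cong₂ (λ u v → not (u ≡ᵇ v)) (distTrunc-fan k n 1≤k 1≤n x z) (distTrunc-fan k n 1≤k 1≤n y z)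
    dist-res : ∀ x y z → inR (dist (fan n)) x y z ≡ fanRes n (toℕ x) (toℕ y) (toℕ z)
    dist-res x y z = cong₂ (λ u v → not (u ≡ᵇ v)) (dist-fan n 1≤n x z) (dist-fan n 1≤n y z)

pathDist : ℕ → ℕ → ℕ
pathDist a z = if a ≡ᵇ z then 0 else (if (suc a ≡ᵇ z) ∨ (suc z ≡ᵇ a) then 1 else 2)

pathRes : ℕ → ℕ → ℕ → Bool
pathRes a b z = not (pathDist a z ≡ᵇ pathDist b z)

fanDist-path : ∀ n a z → a < n → z < n → fanDist n a z ≡ pathDist a z
fanDist-path n a z a<n z<n
  rewrite ≢⇒≡ᵇ-false (<⇒≢ a<n) | ≢⇒≡ᵇ-false (<⇒≢ z<n) = refl

fanDist-from-apex : ∀ n z → z < n → fanDist n n z ≡ 1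
fanDist-from-apex n z z<n
  rewrite ≢⇒≡ᵇ-false (≢-sym (<⇒≢ z<n)) | ≡ᵇ-refl n | ≢⇒≡ᵇ-false (<⇒≢ z<n) = refl

fanDist-to-apex : ∀ n a → a < n → fanDist n a n ≡ 1
fanDist-to-apex n a a<n rewrite ≢⇒≡ᵇ-false (<⇒≢ a<n) | ≡ᵇ-refl n = refl

fanRes-path : ∀ n a b z → a < n → b < n → z < n → fanRes n a b z ≡ pathRes a b z
fanRes-path n a b z a<n b<n z<n =
  cong₂ (λ u v → not (u ≡ᵇ v)) (fanDist-path n a z a<n z<n) (fanDist-path n b z b<n z<n)

fanRes-sym : ∀ n a b z → fanRes n a b z ≡ fanRes n b a z
fanRes-sym n a b z = cong not (≡ᵇ-sym (fanDist n a z) (fanDist n b z))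

pathDist-+ : ∀ c s r → pathDist (c + s) (c + r) ≡ pathDist s r
pathDist-+ zero    s r = refl
pathDist-+ (suc c) s r = pathDist-+ c s r

pathDist-+ʳ : ∀ s r c → pathDist (s + c) (r + c) ≡ pathDist s r
pathDist-+ʳ s r c = trans (cong₂ pathDist (+-comm s c) (+-comm r c)) (pathDist-+ c s r)

pathRes-+ʳ : ∀ s t r c → pathRes (s + c) (t + c) (r + c) ≡ pathRes s t r
pathRes-+ʳ s t r c = cong₂ (λ u v → not (u ≡ᵇ v)) (pathDist-+ʳ s r c) (pathDist-+ʳ t r c)

pathDist-farʳ : ∀ a z → 2 + a ≤ z → pathDist a z ≡ 2
pathDist-farʳ a z 2+a≤z
  rewrite ≢⇒≡ᵇ-false (<⇒≢ (<-trans (n<1+n a) 2+a≤z))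
        | ≢⇒≡ᵇ-false (<⇒≢ 2+a≤z)
        | ≢⇒≡ᵇ-false (≢-sym (<⇒≢ (≤-trans (n≤1+n _) (≤-trans 2+a≤z (n≤1+n z))))) = refl

pathDist-farˡ : ∀ a z → 2 + z ≤ a → pathDist a z ≡ 2
pathDist-farˡ a z 2+z≤a
  rewrite ≢⇒≡ᵇ-false (≢-sym (<⇒≢ (<-trans (n<1+n z) 2+z≤a)))
        | ≢⇒≡ᵇ-false (≢-sym (<⇒≢ (≤-trans (n≤1+n _) (≤-trans 2+z≤a (n≤1+n a)))))
        | ≢⇒≡ᵇ-false (<⇒≢ 2+z≤a) = refl

pathDist-pred : ∀ a → pathDist a (pred a) ≤ 1
pathDist-pred zero    = z≤n
pathDist-pred (suc c) = ≤-reflexive (pathDist-+ʳ 1 0 c)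

pathRes-near-far : ∀ a b z → pathDist a z ≤ 1 → pathDist b z ≡ 2 → pathRes a b z ≡ true
pathRes-near-far a b z near far rewrite far with pathDist a z | near
... | 0           | _              = refl
... | 1           | _              = refl
... | suc (suc _) | s≤s ()

pathRes-far-near : ∀ a b z → pathDist a z ≡ 2 → pathDist b z ≤ 1 → pathRes a b z ≡ true
pathRes-far-near a b z far near =
  trans (cong not (≡ᵇ-sym (pathDist a z) (pathDist b z))) (pathRes-near-far b a z near far)

+-nest₄ : ∀ w x y z → w + x + y + z ≡ w + (x + (y + (z + 0)))
+-nest₄ = solve-∀

+-nest₆ : ∀ u v w x y z → u + v + w + (x + y + z) ≡ u + (v + (w + (x + (y + (z + 0)))))
+-nest₆ = solve-∀

<⇒≡+suc : ∀ {a b} → a < b → Σ ℕ (λ o → b ≡ o + suc a)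
<⇒≡+suc {a} a<b with m≤n⇒∃[o]m+o≡n a<b
... | o , 1+a+o≡b = o , trans (sym 1+a+o≡b) (+-comm (suc a) o)

-- For path vertices a < b, the set R{a,b} contains the path vertices a - 1, a, a + 1, a + 2
-- if b = a + 1, the vertices a - 1, a, a + 2, a + 3 if b = a + 2, and the vertices
-- a - 1, a, a + 1, b - 1, b, b + 1 otherwise; R{a, apex} misses only a - 1 and a + 1.
record PathWindows (n D M τ : ℕ) (G : ℕ → ℕ) : Set where
  field
    vanishes : ∀ z → n ≤ z → G z ≡ 0
    bounded  : ∀ z → G z ≤ M
    M≤D      : M ≤ D
    window-1 : ∀ a → 1 + a < n → D ≤ back 1 G a + G a + G (1 + a) + G (2 + a)
    window-2 : ∀ a → 2 + a < n → D ≤ back 1 G a + G a + G (2 + a) + G (3 + a)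
    triple   : ∀ a → a < n → τ ≤ back 1 G a + G a + G (1 + a)
    D≤τ+τ    : D ≤ τ + τ
    apex     : D + (M + M) ≤ sumBelow n G

module PathWindows⇒Primal {n d M τ : ℕ} {G : ℕ → ℕ} (W : PathWindows n (suc d) M τ G) where
  open PathWindows W

  H : ℕ → ℕ → ℕ → ℕ
  H a b z = ind (fanRes n a b z) (G z)

  counted : ∀ a b u → a < n → b < n → pathRes a b u ≡ true → CountedIn (suc n) (H a b) G u
  counted a b u a<n b<n res with u <? n
  ... | yes u<n = inj₁ (≤-trans u<n (n≤1+n n) , cong (λ r → ind r (G u)) (trans (fanRes-path n a b u a<n b<n u<n) res))
  ... | no  u≮n = inj₂ (vanishes u (≮⇒≥ u≮n))

  window : ∀ a b us → a < n → b < n → Linked _<_ (a ∷ us) →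
    All (λ u → pathRes a b u ≡ true) (pred a ∷ a ∷ us) →
    back 1 G a + sum (map G (a ∷ us)) ≤ sumBelow (suc n) (H a b)
  window zero    b us a<n b<n sorted (_ ∷ resolved) =
    sum-distinct≤sumBelow (suc n) (H 0 b) G (0 ∷ us) (sorted⇒distinct sorted)
      (All.map (λ {u} → counted 0 b u a<n b<n) resolved)
  window (suc c) b us a<n b<n sorted resolved =
    sum-distinct≤sumBelow (suc n) (H (suc c) b) G (c ∷ suc c ∷ us) (sorted⇒distinct (n<1+n c ∷ sorted))
      (All.map (λ {u} → counted (suc c) b u a<n b<n) resolved)

  shifted : ∀ s t r c → pathRes s t r ≡ true → pathRes (s + c) (t + c) (r + c) ≡ true
  shifted s t r c res = trans (pathRes-+ʳ s t r c) res

  resolves-1 : ∀ a → 1 + a < n → suc d ≤ sumBelow (suc n) (H a (1 + a))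
  resolves-1 a 1+a<n = ≤-trans (window-1 a 1+a<n)
    (≤-trans (≤-reflexive (+-nest₄ (back 1 G a) (G a) (G (1 + a)) (G (2 + a))))
      (window a (1 + a) (1 + a ∷ 2 + a ∷ []) (<-trans (n<1+n a) 1+a<n) 1+a<n (n<1+n a ∷ n<1+n _ ∷ [-]) (resolved a)))
    where
    resolved : ∀ a → All (λ u → pathRes a (1 + a) u ≡ true) (pred a ∷ a ∷ 1 + a ∷ 2 + a ∷ [])
    resolved zero    = refl ∷ refl ∷ refl ∷ refl ∷ []
    resolved (suc c) = shifted 1 2 0 c refl ∷ shifted 1 2 1 c refl ∷ shifted 1 2 2 c refl ∷ shifted 1 2 3 c refl ∷ []

  resolves-2 : ∀ a → 2 + a < n → suc d ≤ sumBelow (suc n) (H a (2 + a))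
  resolves-2 a 2+a<n = ≤-trans (window-2 a 2+a<n)
    (≤-trans (≤-reflexive (+-nest₄ (back 1 G a) (G a) (G (2 + a)) (G (3 + a))))
      (window a (2 + a) (2 + a ∷ 3 + a ∷ []) (<-trans (≤-trans (n<1+n a) (n≤1+n _)) 2+a<n) 2+a<n
        (≤-trans (n<1+n a) (n≤1+n _) ∷ n<1+n _ ∷ [-]) (resolved a)))
    where
    resolved : ∀ a → All (λ u → pathRes a (2 + a) u ≡ true) (pred a ∷ a ∷ 2 + a ∷ 3 + a ∷ [])
    resolved zero    = refl ∷ refl ∷ refl ∷ refl ∷ []
    resolved (suc c) = shifted 1 3 0 c refl ∷ shifted 1 3 1 c refl ∷ shifted 1 3 3 c refl ∷ shifted 1 3 4 c refl ∷ []

  resolves-far : ∀ a e → 2 + (e + suc a) < n → suc d ≤ sumBelow (suc n) (H a (2 + (e + suc a)))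
  resolves-far a e b<n = ≤-trans D≤τ+τ (≤-trans (+-mono-≤ (triple a a<n) (triple b b<n))
    (≤-trans (≤-reflexive (+-nest₆ (back 1 G a) (G a) (G (1 + a)) (G b′) (G b) (G (1 + b))))
      (window a b (1 + a ∷ b′ ∷ b ∷ 1 + b ∷ []) a<n b<n
        (n<1+n a ∷ s≤s (m≤n+m (suc a) e) ∷ n<1+n b′ ∷ n<1+n b ∷ [-]) resolved)))
    where
    b′ b : ℕ
    b′ = 1 + (e + suc a)
    b  = suc b′
    2+a≤b′ : 2 + a ≤ b′
    2+a≤b′ = s≤s (m≤n+m (suc a) e)
    a<n : a < n
    a<n = <-trans (≤-trans (n≤1+n _) (≤-trans 2+a≤b′ (n≤1+n b′))) b<n
    near-a : ∀ u → u ≤ 1 + a → pathDist b u ≡ 2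
    near-a u u≤1+a = pathDist-farˡ b u (s≤s (s≤s (≤-trans u≤1+a (m≤n+m (suc a) e))))
    near-b : ∀ r → pathDist a (r + b′) ≡ 2
    near-b r = pathDist-farʳ a (r + b′) (≤-trans 2+a≤b′ (m≤n+m b′ r))
    resolved : All (λ u → pathRes a b u ≡ true) (pred a ∷ a ∷ 1 + a ∷ b′ ∷ b ∷ 1 + b ∷ [])
    resolved =
        pathRes-near-far a b (pred a) (pathDist-pred a) (near-a (pred a) (≤-trans pred[n]≤n (n≤1+n a)))
      ∷ pathRes-near-far a b a (≤-trans (≤-reflexive (pathDist-+ʳ 0 0 a)) z≤n) (near-a a (n≤1+n a))
      ∷ pathRes-near-far a b (1 + a) (≤-reflexive (pathDist-+ʳ 0 1 a)) (near-a (1 + a) ≤-refl)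
      ∷ pathRes-far-near a b b′ (near-b 0) (≤-reflexive (pathDist-+ʳ 1 0 b′))
      ∷ pathRes-far-near a b b (near-b 1) (≤-trans (≤-reflexive (pathDist-+ʳ 1 1 b′)) z≤n)
      ∷ pathRes-far-near a b (1 + b) (near-b 2) (≤-reflexive (pathDist-+ʳ 1 2 b′)) ∷ []

  resolves-apex : ∀ a → a < n → suc d ≤ sumBelow (suc n) (H a n)
  resolves-apex a a<n = ≤-trans
    (+-cancelʳ-≤ (M + M) (suc d) (sumBelow n (H a n)) (≤-trans apex path-bound))
    (≤-trans (m≤m+n _ _) (≤-reflexive (sym (sumBelow-last n (H a n)))))
    where
    leftOf rightOf : ℕ → ℕ
    leftOf  z = ind (suc z ≡ᵇ a) (G z)
    rightOf z = ind (suc a ≡ᵇ z) (G z)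
    unresolved-are-neighbours : ∀ e l r g →
      g ≤ ind (not ((if e then 0 else (if l ∨ r then 1 else 2)) ≡ᵇ 1)) g + ind r g + ind l g
    unresolved-are-neighbours true  l     r     g = ≤-trans (m≤m+n g _) (≤-reflexive (sym (+-assoc g _ _)))
    unresolved-are-neighbours false true  true  g = m≤n+m g _
    unresolved-are-neighbours false true  false g = m≤n+m g _
    unresolved-are-neighbours false false true  g = m≤m+n g 0
    unresolved-are-neighbours false false false g = ≤-reflexive (sym (trans (+-identityʳ _) (+-identityʳ g)))
    pointwise : ∀ z → z < n → G z ≤ H a n z + leftOf z + rightOf z
    pointwise z z<n rewrite fanDist-path n a z a<n z<n | fanDist-from-apex n z z<n =
      unresolved-are-neighbours (a ≡ᵇ z) (suc a ≡ᵇ z) (suc z ≡ᵇ a) (G z)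
    leftOf-total : sumBelow n leftOf ≤ M
    leftOf-total = ≤-trans (sumBelow-at-pred n a G) (bounded (pred a))
    rightOf-total : sumBelow n rightOf ≤ M
    rightOf-total = ≤-trans (≤-reflexive (sumBelow-cong n (λ z → cong (λ r → ind r (G z)) (≡ᵇ-sym (suc a) z))))
                            (≤-trans (sumBelow-at n (suc a) G) (bounded (suc a)))
    path-bound : sumBelow n G ≤ sumBelow n (H a n) + (M + M)
    path-bound = begin
      sumBelow n G                                                     ≤⟨ sumBelow-mono-≤ n pointwise ⟩
      sumBelow n (λ z → H a n z + leftOf z + rightOf z)
        ≡⟨ sumBelow-+ n _ rightOf ⟩
      sumBelow n (λ z → H a n z + leftOf z) + sumBelow n rightOf
        ≡⟨ cong (_+ sumBelow n rightOf) (sumBelow-+ n (H a n) leftOf) ⟩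
      sumBelow n (H a n) + sumBelow n leftOf + sumBelow n rightOf
        ≤⟨ +-mono-≤ (+-monoʳ-≤ (sumBelow n (H a n)) leftOf-total) rightOf-total ⟩
      sumBelow n (H a n) + M + M
        ≡⟨ +-assoc (sumBelow n (H a n)) M M ⟩
      sumBelow n (H a n) + (M + M) ∎
      where open ≤-Reasoning

  resolves-< : ∀ a b → a < b → b ≤ n → suc d ≤ sumBelow (suc n) (H a b)
  resolves-< a b a<b b≤n with m≤n⇒m<n∨m≡n b≤n
  ... | inj₂ refl = resolves-apex a a<b
  ... | inj₁ b<n with <⇒≡+suc a<b
  ...   | 0           , refl = resolves-1 a b<n
  ...   | 1           , refl = resolves-2 a b<n
  ...   | suc (suc e) , refl = resolves-far a e b<n

  primal : IsPrimalCertificate (fanRes n) n d G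
  primal = (λ z _ → ≤-trans (bounded z) M≤D) , resolves
    where
    resolves : ∀ a b → a ≤ n → b ≤ n → a ≢ b → suc d ≤ sumBelow (suc n) (H a b)
    resolves a b a≤n b≤n a≢b with <-cmp a b
    ... | tri< a<b _   _   = resolves-< a b a<b b≤n
    ... | tri≈ _   a≡b _   = ⊥-elim (a≢b a≡b)
    ... | tri> _   _   b<a = subst (suc d ≤_) (sumBelow-cong (suc n) (λ z → cong (λ r → ind r (G z)) (fanRes-sym n b a z)))
                               (resolves-< b a b<a a≤n)

pathRes-gap-1 : ∀ a z → pathRes a (1 + a) z ≡ ((suc z ≡ᵇ a) ∨ (z ≡ᵇ a) ∨ (z ≡ᵇ 1 + a) ∨ (z ≡ᵇ 2 + a))
pathRes-gap-1 zero          zero                      = refl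
pathRes-gap-1 zero          (suc zero)                = refl
pathRes-gap-1 zero          (suc (suc zero))          = refl
pathRes-gap-1 zero          (suc (suc (suc z)))       = refl
pathRes-gap-1 (suc zero)    zero                      = refl
pathRes-gap-1 (suc (suc a)) zero                      = refl
pathRes-gap-1 (suc a)       (suc z)                   = pathRes-gap-1 a z

pathRes-gap-2 : ∀ a z → pathRes a (2 + a) z ≡ ((suc z ≡ᵇ a) ∨ (z ≡ᵇ a) ∨ (z ≡ᵇ 2 + a) ∨ (z ≡ᵇ 3 + a))
pathRes-gap-2 zero          zero                      = refl
pathRes-gap-2 zero          (suc zero)                = refl
pathRes-gap-2 zero          (suc (suc zero))          = refl
pathRes-gap-2 zero          (suc (suc (suc zero)))    = refl
pathRes-gap-2 zero          (suc (suc (suc (suc z)))) = refl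
pathRes-gap-2 (suc zero)    zero                      = refl
pathRes-gap-2 (suc (suc a)) zero                      = refl
pathRes-gap-2 (suc a)       (suc z)                   = pathRes-gap-2 a z

pairsAtGap : ℕ → (ℕ → ℕ) → ℕ → List WeightedPair
pairsAtGap g C K = applyUpTo (λ a → wpair (C a) a (g + a)) K

sum-map-applyUpTo : ∀ {A : Set} (h : A → ℕ) f K → sum (map h (applyUpTo f K)) ≡ sumBelow K (λ a → h (f a))
sum-map-applyUpTo h f zero    = refl
sum-map-applyUpTo h f (suc K) = cong (λ t → h (f 0) + t) (sum-map-applyUpTo h (λ a → f (suc a)) K)

totalWeight-pairsAtGap : ∀ g C K → totalWeight (pairsAtGap g C K) ≡ sumBelow K C
totalWeight-pairsAtGap g C K = sum-map-applyUpTo pairWeight _ K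

coverage-pairsAtGap : ∀ Res g C K z →
  coverage Res (pairsAtGap g C K) z ≡ sumBelow K (λ a → ind (Res a (g + a) z) (C a))
coverage-pairsAtGap Res g C K z = sum-map-applyUpTo _ _ K

coverage-++ : ∀ Res L L′ z → coverage Res (L ++ L′) z ≡ coverage Res L z + coverage Res L′ z
coverage-++ Res L L′ z = trans (cong sum (map-++ _ L L′)) (sum-++ (map _ L) (map _ L′))

totalWeight-++ : ∀ L L′ → totalWeight (L ++ L′) ≡ totalWeight L + totalWeight L′
totalWeight-++ L L′ = trans (cong sum (map-++ pairWeight L L′)) (sum-++ (map pairWeight L) (map pairWeight L′))

module Band (n g : ℕ) (C : ℕ → ℕ) (K : ℕ) (C-vanishes : ∀ a → a < K → n ≤ g + a → C a ≡ 0) where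

  coverage-path : ∀ z → z < n →
    coverage (fanRes n) (pairsAtGap g C K) z ≤ sumBelow K (λ a → ind (pathRes a (g + a) z) (C a))
  coverage-path z z<n = ≤-trans (≤-reflexive (coverage-pairsAtGap (fanRes n) g C K z)) (sumBelow-mono-≤ K pointwise)
    where
    pointwise : ∀ a → a < K → ind (fanRes n a (g + a) z) (C a) ≤ ind (pathRes a (g + a) z) (C a)
    pointwise a a<K with g + a <? n
    ... | yes g+a<n = ≤-reflexive (cong (λ r → ind r (C a))
                        (fanRes-path n a (g + a) z (≤-<-trans (m≤n+m a g) g+a<n) g+a<n z<n))
    ... | no  g+a≮n rewrite C-vanishes a a<K (≮⇒≥ g+a≮n) | ind-zero (fanRes n a (g + a) z) = z≤n

  coverage-apex : coverage (fanRes n) (pairsAtGap g C K) n ≤ 0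
  coverage-apex = ≤-trans (≤-reflexive (coverage-pairsAtGap (fanRes n) g C K n))
    (≤-trans (sumBelow-mono-≤ K pointwise) (≤-reflexive (sumBelow-zero K)))
    where
    pointwise : ∀ a → a < K → ind (fanRes n a (g + a) n) (C a) ≤ 0
    pointwise a a<K with g + a <? n
    ... | yes g+a<n rewrite fanDist-to-apex n a (≤-<-trans (m≤n+m a g) g+a<n) | fanDist-to-apex n (g + a) g+a<n = z≤n
    ... | no  g+a≮n rewrite C-vanishes a a<K (≮⇒≥ g+a≮n) | ind-zero (fanRes n a (g + a) n) = z≤n

  valid : 1 ≤ g → g + K ≤ suc n → All (IsValidPair n) (pairsAtGap g C K)
  valid 1≤g g+K≤1+n = All.applyUpTo⁺₁ _ K (λ {a} a<K → bounds a a<K)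
    where
    bounds : ∀ a → a < K → a ≤ n × g + a ≤ n × a ≢ g + a
    bounds a a<K = ≤-trans (m≤n+m a g) g+a≤n , g+a≤n , <⇒≢ (m<n+m a 1≤g)
      where
      g+a≤n : g + a ≤ n
      g+a≤n = ≤-pred (≤-trans (+-monoʳ-< g a<K) g+K≤1+n)

module TwoBands (n : ℕ) (C₁ C₂ : ℕ → ℕ) (K₂ : ℕ)
  (C₁-vanishes : ∀ a → a < n → n ≤ 1 + a → C₁ a ≡ 0)
  (C₂-vanishes : ∀ a → a < K₂ → n ≤ 2 + a → C₂ a ≡ 0) where

  pairs : List WeightedPair
  pairs = pairsAtGap 1 C₁ n ++ pairsAtGap 2 C₂ K₂

  coverage-path : ∀ z → z < n → coverage (fanRes n) pairs z ≤
    C₁ (suc z) + C₁ z + back 1 C₁ z + back 2 C₁ z + (C₂ (suc z) + C₂ z + back 2 C₂ z + back 3 C₂ z)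
  coverage-path z z<n rewrite coverage-++ (fanRes n) (pairsAtGap 1 C₁ n) (pairsAtGap 2 C₂ K₂) z = +-mono-≤
    (≤-trans (Band.coverage-path n 1 C₁ n C₁-vanishes z z<n)
      (≤-trans (≤-reflexive (sumBelow-cong n (λ a → cong (λ r → ind r (C₁ a)) (pathRes-gap-1 a z))))
        (sumBelow-at-back₄ n C₁ (suc z) 0 z 0 z 1 z 2)))
    (≤-trans (Band.coverage-path n 2 C₂ K₂ C₂-vanishes z z<n)
      (≤-trans (≤-reflexive (sumBelow-cong K₂ (λ a → cong (λ r → ind r (C₂ a)) (pathRes-gap-2 a z))))
        (sumBelow-at-back₄ K₂ C₂ (suc z) 0 z 0 z 2 z 3)))

  coverage-apex : coverage (fanRes n) pairs n ≤ 0
  coverage-apex rewrite coverage-++ (fanRes n) (pairsAtGap 1 C₁ n) (pairsAtGap 2 C₂ K₂) n =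
    +-mono-≤ (Band.coverage-apex n 1 C₁ n C₁-vanishes) (Band.coverage-apex n 2 C₂ K₂ C₂-vanishes)

  valid : 1 + K₂ ≤ n → All (IsValidPair n) pairs
  valid 1+K₂≤n = All.++⁺ (Band.valid n 1 C₁ n C₁-vanishes (s≤s z≤n) ≤-refl)
                         (Band.valid n 2 C₂ K₂ C₂-vanishes (s≤s z≤n) (s≤s 1+K₂≤n))

  totalWeight-pairs : totalWeight pairs ≡ sumBelow n C₁ + sumBelow K₂ C₂
  totalWeight-pairs = trans (totalWeight-++ (pairsAtGap 1 C₁ n) (pairsAtGap 2 C₂ K₂))
    (cong₂ _+_ (totalWeight-pairsAtGap 1 C₁ n) (totalWeight-pairsAtGap 2 C₂ K₂))

entry : List ℕ → ℕ → ℕ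
entry []      _       = 0
entry (x ∷ L) zero    = x
entry (x ∷ L) (suc i) = entry L i

entry-beyond : ∀ L i → length L ≤ i → entry L i ≡ 0
entry-beyond []      i       _         = refl
entry-beyond (x ∷ L) (suc i) (s≤s L≤i) = entry-beyond L i L≤i

entry-≤ : ∀ {M} L → All (_≤ M) L → ∀ i → entry L i ≤ M
entry-≤ []      []           i       = z≤n
entry-≤ (x ∷ L) (x≤M ∷ _)    zero    = x≤M
entry-≤ (x ∷ L) (_   ∷ L≤M) (suc i) = entry-≤ L L≤M i

sumBelow-entry : ∀ L → sumBelow (length L) (entry L) ≡ sum L
sumBelow-entry []      = refl
sumBelow-entry (x ∷ L) = cong (λ t → x + t) (sumBelow-entry L)

sumBelow-entry-length : ∀ m L → length L ≡ m → sumBelow m (entry L) ≡ sum L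
sumBelow-entry-length m L refl = sumBelow-entry L

prev₁ : ℕ → List ℕ → ℕ → ℕ
prev₁ p L zero    = p
prev₁ p L (suc z) = entry L z

prev₂ : ℕ → ℕ → List ℕ → ℕ → ℕ
prev₂ p₁ p₂ L zero    = p₂
prev₂ p₁ p₂ L (suc z) = prev₁ p₁ L z

prev₃ : ℕ → ℕ → ℕ → List ℕ → ℕ → ℕ
prev₃ p₁ p₂ p₃ L zero    = p₃
prev₃ p₁ p₂ p₃ L (suc z) = prev₂ p₁ p₂ L z

prev₁-∷ : ∀ p x L z → prev₁ p (x ∷ L) (suc z) ≡ prev₁ x L z
prev₁-∷ p x L zero    = refl
prev₁-∷ p x L (suc z) = refl

prev₂-∷ : ∀ p₁ p₂ x L z → prev₂ p₁ p₂ (x ∷ L) (suc z) ≡ prev₂ x p₁ L z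
prev₂-∷ p₁ p₂ x L zero    = refl
prev₂-∷ p₁ p₂ x L (suc z) = prev₁-∷ p₁ x L z

prev₃-∷ : ∀ p₁ p₂ p₃ x L z → prev₃ p₁ p₂ p₃ (x ∷ L) (suc z) ≡ prev₃ x p₁ p₂ L z
prev₃-∷ p₁ p₂ p₃ x L zero    = refl
prev₃-∷ p₁ p₂ p₃ x L (suc z) = prev₂-∷ p₁ p₂ x L z

prev₁-0 : ∀ L z → prev₁ 0 L z ≡ back 1 (entry L) z
prev₁-0 L zero    = refl
prev₁-0 L (suc z) = refl

prev₂-0 : ∀ L z → prev₂ 0 0 L z ≡ back 2 (entry L) z
prev₂-0 L zero    = refl
prev₂-0 L (suc z) = prev₁-0 L z

prev₃-0 : ∀ L z → prev₃ 0 0 0 L z ≡ back 3 (entry L) z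
prev₃-0 L zero    = refl
prev₃-0 L (suc z) = prev₂-0 L z

-- The window bounds of PathWindows read along a list of weights; p is the preceding weight.
Windows : ℕ → ℕ → ℕ → List ℕ → Set
Windows D τ p []                  = ⊤
Windows D τ p (x ∷ [])            = τ ≤ p + x + 0
Windows D τ p (x ∷ y ∷ [])        = τ ≤ p + x + y × D ≤ p + x + y + 0 × Windows D τ x (y ∷ [])
Windows D τ p (x ∷ y ∷ z ∷ [])    =
  τ ≤ p + x + y × D ≤ p + x + y + z × D ≤ p + x + z + 0 × Windows D τ x (y ∷ z ∷ [])
Windows D τ p (x ∷ y ∷ z ∷ w ∷ L) =
  τ ≤ p + x + y × D ≤ p + x + y + z × D ≤ p + x + z + w × Windows D τ x (y ∷ z ∷ w ∷ L)

module _ {D τ : ℕ} where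

  windows-1 : ∀ p L → Windows D τ p L → ∀ a → 1 + a < length L →
    D ≤ prev₁ p L a + entry L a + entry L (1 + a) + entry L (2 + a)
  windows-1 p (x ∷ [])            _               zero    (s≤s ())
  windows-1 p (x ∷ y ∷ [])        (_ , w , _)     zero    _ = w
  windows-1 p (x ∷ y ∷ z ∷ [])    (_ , w , _)     zero    _ = w
  windows-1 p (x ∷ y ∷ z ∷ w ∷ L) (_ , w′ , _)    zero    _ = w′
  windows-1 p (x ∷ y ∷ [])        _               (suc a) (s≤s (s≤s ()))
  windows-1 p (x ∷ y ∷ z ∷ [])    (_ , _ , _ , W) (suc a) (s≤s 2+a<n)
    rewrite prev₁-∷ p x (y ∷ z ∷ []) a = windows-1 x (y ∷ z ∷ []) W a 2+a<n
  windows-1 p (x ∷ y ∷ z ∷ w ∷ L) (_ , _ , _ , W) (suc a) (s≤s 2+a<n)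
    rewrite prev₁-∷ p x (y ∷ z ∷ w ∷ L) a = windows-1 x (y ∷ z ∷ w ∷ L) W a 2+a<n

  windows-2 : ∀ p L → Windows D τ p L → ∀ a → 2 + a < length L →
    D ≤ prev₁ p L a + entry L a + entry L (2 + a) + entry L (3 + a)
  windows-2 p (x ∷ [])            _               zero    (s≤s ())
  windows-2 p (x ∷ y ∷ [])        _               zero    (s≤s (s≤s ()))
  windows-2 p (x ∷ y ∷ z ∷ [])    (_ , _ , w , _) zero    _ = w
  windows-2 p (x ∷ y ∷ z ∷ w ∷ L) (_ , _ , w′ , _) zero   _ = w′
  windows-2 p (x ∷ y ∷ [])        _               (suc a) (s≤s (s≤s ()))
  windows-2 p (x ∷ y ∷ z ∷ [])    _               (suc a) (s≤s (s≤s (s≤s ())))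
  windows-2 p (x ∷ y ∷ z ∷ w ∷ L) (_ , _ , _ , W) (suc a) (s≤s 3+a<n)
    rewrite prev₁-∷ p x (y ∷ z ∷ w ∷ L) a = windows-2 x (y ∷ z ∷ w ∷ L) W a 3+a<n

  windows-triple : ∀ p L → Windows D τ p L → ∀ a → a < length L →
    τ ≤ prev₁ p L a + entry L a + entry L (1 + a)
  windows-triple p (x ∷ [])            w       zero    _ = w
  windows-triple p (x ∷ y ∷ [])        (w , _) zero    _ = w
  windows-triple p (x ∷ y ∷ z ∷ [])    (w , _) zero    _ = w
  windows-triple p (x ∷ y ∷ z ∷ w ∷ L) (t , _) zero    _ = t
  windows-triple p (x ∷ [])            _       (suc a) (s≤s ())
  windows-triple p (x ∷ y ∷ [])        (_ , _ , W) (suc a) (s≤s 1+a<n)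
    rewrite prev₁-∷ p x (y ∷ []) a = windows-triple x (y ∷ []) W a 1+a<n
  windows-triple p (x ∷ y ∷ z ∷ [])    (_ , _ , _ , W) (suc a) (s≤s 1+a<n)
    rewrite prev₁-∷ p x (y ∷ z ∷ []) a = windows-triple x (y ∷ z ∷ []) W a 1+a<n
  windows-triple p (x ∷ y ∷ z ∷ w ∷ L) (_ , _ , _ , W) (suc a) (s≤s 1+a<n)
    rewrite prev₁-∷ p x (y ∷ z ∷ w ∷ L) a = windows-triple x (y ∷ z ∷ w ∷ L) W a 1+a<n

windows⇒pathWindows : ∀ D M τ L → Windows D τ 0 L → All (_≤ M) L → M ≤ D → D ≤ τ + τ →
  D + (M + M) ≤ sum L → PathWindows (length L) D M τ (entry L)
windows⇒pathWindows D M τ L W L≤M M≤D D≤τ+τ apex = record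
  { vanishes = entry-beyond L
  ; bounded  = entry-≤ L L≤M
  ; M≤D      = M≤D
  ; window-1 = λ a 1+a<n → subst (λ t → D ≤ t + entry L a + entry L (1 + a) + entry L (2 + a)) (prev₁-0 L a)
                             (windows-1 0 L W a 1+a<n)
  ; window-2 = λ a 2+a<n → subst (λ t → D ≤ t + entry L a + entry L (2 + a) + entry L (3 + a)) (prev₁-0 L a)
                             (windows-2 0 L W a 2+a<n)
  ; triple   = λ a a<n → subst (λ t → τ ≤ t + entry L a + entry L (1 + a)) (prev₁-0 L a) (windows-triple 0 L W a a<n)
  ; D≤τ+τ    = D≤τ+τ
  ; apex     = subst (D + (M + M) ≤_) (sym (sumBelow-entry L)) apex
  }

-- The coverage bound of TwoBands read along the two lists of dual weights;
-- p₁, p₂ and q₁, q₂, q₃ are the preceding entries.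
Coverage : ℕ → ℕ → ℕ → ℕ → ℕ → ℕ → List ℕ → List ℕ → Set
Coverage D p₁ p₂ q₁ q₂ q₃ (x ∷ []) (y ∷ []) = 0 + x + p₁ + p₂ + (0 + y + q₂ + q₃) ≤ D
Coverage D p₁ p₂ q₁ q₂ q₃ (x ∷ x′ ∷ L₁) (y ∷ y′ ∷ L₂) =
  x′ + x + p₁ + p₂ + (y′ + y + q₂ + q₃) ≤ D × Coverage D x p₁ y q₁ q₂ (x′ ∷ L₁) (y′ ∷ L₂)
Coverage D p₁ p₂ q₁ q₂ q₃ _ _ = ⊤

coverage-at : ∀ D p₁ p₂ q₁ q₂ q₃ L₁ L₂ → Coverage D p₁ p₂ q₁ q₂ q₃ L₁ L₂ → length L₁ ≡ length L₂ →
  ∀ z → z < length L₁ →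
  entry L₁ (suc z) + entry L₁ z + prev₁ p₁ L₁ z + prev₂ p₁ p₂ L₁ z
    + (entry L₂ (suc z) + entry L₂ z + prev₂ q₁ q₂ L₂ z + prev₃ q₁ q₂ q₃ L₂ z) ≤ D
coverage-at D p₁ p₂ q₁ q₂ q₃ (x ∷ []) (y ∷ []) c _ zero _ = c
coverage-at D p₁ p₂ q₁ q₂ q₃ (x ∷ x′ ∷ L₁) (y ∷ y′ ∷ L₂) (c , _) _ zero _ = c
coverage-at D p₁ p₂ q₁ q₂ q₃ (x ∷ x′ ∷ L₁) (y ∷ y′ ∷ L₂) (_ , C) lengths (suc z) (s≤s z<n)
  rewrite prev₁-∷ p₁ x (x′ ∷ L₁) z | prev₂-∷ p₁ p₂ x (x′ ∷ L₁) z
        | prev₂-∷ q₁ q₂ y (y′ ∷ L₂) z | prev₃-∷ q₁ q₂ q₃ y (y′ ∷ L₂) z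
  = coverage-at D x p₁ y q₁ q₂ (x′ ∷ L₁) (y′ ∷ L₂) C (suc-injective lengths) z z<n
coverage-at D p₁ p₂ q₁ q₂ q₃ (x ∷ []) (y ∷ []) _ _ (suc z) (s≤s ())
coverage-at D p₁ p₂ q₁ q₂ q₃ (x ∷ []) (y ∷ _ ∷ _) _ () _ _
coverage-at D p₁ p₂ q₁ q₂ q₃ (x ∷ _ ∷ _) (y ∷ []) _ () _ _

LastIsZero : List ℕ → Set
LastIsZero []          = ⊤
LastIsZero (x ∷ [])    = x ≡ 0
LastIsZero (x ∷ y ∷ L) = LastIsZero (y ∷ L)

PenultimateIsZero : List ℕ → Set
PenultimateIsZero []              = ⊤
PenultimateIsZero (x ∷ [])        = ⊤
PenultimateIsZero (x ∷ y ∷ [])    = x ≡ 0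
PenultimateIsZero (x ∷ y ∷ z ∷ L) = PenultimateIsZero (y ∷ z ∷ L)

last-entry : ∀ L → LastIsZero L → ∀ a → suc a ≡ length L → entry L a ≡ 0
last-entry (x ∷ [])    x≡0  zero    refl = x≡0
last-entry (x ∷ y ∷ L) last (suc a) eq   = last-entry (y ∷ L) last a (suc-injective eq)

penultimate-entry : ∀ L → PenultimateIsZero L → ∀ a → 2 + a ≡ length L → entry L a ≡ 0
penultimate-entry (x ∷ y ∷ [])    x≡0 zero    refl = x≡0
penultimate-entry (x ∷ y ∷ z ∷ L) pen (suc a) eq   = penultimate-entry (y ∷ z ∷ L) pen a (suc-injective eq)

record ListCertificates (n d : ℕ) : Set where
  field
    weights dual₁ dual₂ : List ℕ
    M τ                 : ℕ
    length-weights      : length weights ≡ n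
    length-dual₁        : length dual₁ ≡ n
    length-dual₂        : length dual₂ ≡ n
    windows             : Windows (suc d) τ 0 weights
    bounded             : All (_≤ M) weights
    M≤D                 : M ≤ suc d
    D≤τ+τ               : suc d ≤ τ + τ
    apex                : suc d + (M + M) ≤ sum weights
    dual₁-last          : LastIsZero dual₁
    dual₂-last          : LastIsZero dual₂
    dual₂-penultimate   : PenultimateIsZero dual₂
    covered             : Coverage (suc d) 0 0 0 0 0 dual₁ dual₂
    sums                : sum weights ≡ sum dual₁ + sum dual₂

module FromLists {k n d : ℕ} (1≤k : 1 ≤ k) (C : ListCertificates (suc n) d) where
  open ListCertificates C

  C₁ C₂ : ℕ → ℕ
  C₁ = entry dual₁
  C₂ = entry dual₂

  C₁-vanishes : ∀ a → a < suc n → suc n ≤ 1 + a → C₁ a ≡ 0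
  C₁-vanishes a (s≤s a≤n) (s≤s n≤a) = last-entry dual₁ dual₁-last a (trans (cong suc (≤-antisym a≤n n≤a)) (sym length-dual₁))

  C₂-vanishes : ∀ a → a < n → suc n ≤ 2 + a → C₂ a ≡ 0
  C₂-vanishes a a<n n+1≤a+2 =
    penultimate-entry dual₂ dual₂-penultimate a (trans (≤-antisym (s≤s a<n) n+1≤a+2) (sym length-dual₂))

  open TwoBands (suc n) C₁ C₂ n C₁-vanishes C₂-vanishes

  primal : IsPrimalCertificate (fanRes (suc n)) (suc n) d (entry weights)
  primal = PathWindows⇒Primal.primal
    (subst (λ m → PathWindows m (suc d) M τ (entry weights)) length-weights
      (windows⇒pathWindows (suc d) M τ weights windows bounded M≤D D≤τ+τ apex))

  dual : IsDualCertificate (fanRes (suc n)) (suc n) d pairs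
  dual = valid ≤-refl , covered-at
    where
    covered-at : ∀ z → z ≤ suc n → coverage (fanRes (suc n)) pairs z ≤ suc d
    covered-at z z≤1+n with m≤n⇒m<n∨m≡n z≤1+n
    ... | inj₂ refl = ≤-trans coverage-apex z≤n
    ... | inj₁ z<n  = ≤-trans (coverage-path z z<n) (subst (_≤ suc d) from-lists
        (coverage-at (suc d) 0 0 0 0 0 dual₁ dual₂ covered (trans length-dual₁ (sym length-dual₂)) z
          (subst (z <_) (sym length-dual₁) z<n)))
      where
      from-lists : entry dual₁ (suc z) + entry dual₁ z + prev₁ 0 dual₁ z + prev₂ 0 0 dual₁ z
                   + (entry dual₂ (suc z) + entry dual₂ z + prev₂ 0 0 dual₂ z + prev₃ 0 0 0 dual₂ z)
                 ≡ C₁ (suc z) + C₁ z + back 1 C₁ z + back 2 C₁ z + (C₂ (suc z) + C₂ z + back 2 C₂ z + back 3 C₂ z)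
      from-lists rewrite prev₁-0 dual₁ z | prev₂-0 dual₁ z | prev₂-0 dual₂ z | prev₃-0 dual₂ z = refl

  weights-sum : sumBelow (suc (suc n)) (entry weights) ≡ sum weights
  weights-sum = begin
    sumBelow (suc (suc n)) (entry weights)                   ≡⟨ sumBelow-last (suc n) (entry weights) ⟩
    sumBelow (suc n) (entry weights) + entry weights (suc n)
      ≡⟨ cong₂ _+_ (sumBelow-entry-length (suc n) weights length-weights)
                   (entry-beyond weights (suc n) (≤-reflexive length-weights)) ⟩
    sum weights + 0                                          ≡⟨ +-identityʳ _ ⟩
    sum weights                                              ∎
    where open ≡-Reasoning

  pairs-sum : totalWeight pairs ≡ sum weights
  pairs-sum = begin
    totalWeight pairs                     ≡⟨ totalWeight-pairs ⟩
    sumBelow (suc n) C₁ + sumBelow n C₂   ≡⟨ cong₂ _+_ (sumBelow-entry-length (suc n) dual₁ length-dual₁) sum-dual₂ ⟩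
    sum dual₁ + sum dual₂                 ≡⟨ sums ⟨
    sum weights                           ∎
    where
    open ≡-Reasoning
    sum-dual₂ : sumBelow n C₂ ≡ sum dual₂
    sum-dual₂ = begin
      sumBelow n C₂         ≡⟨ +-identityʳ _ ⟨
      sumBelow n C₂ + 0     ≡⟨ cong (λ t → sumBelow n C₂ + t) (last-entry dual₂ dual₂-last n (sym length-dual₂)) ⟨
      sumBelow n C₂ + C₂ n  ≡⟨ sumBelow-last n C₂ ⟨
      sumBelow (suc n) C₂   ≡⟨ sumBelow-entry-length (suc n) dual₂ length-dual₂ ⟩
      sum dual₂             ∎

  dims : HasFracDims k (suc n) (sum weights /1+ d)
  dims = subst (λ v → HasFracDims k (suc n) (v /1+ d)) pairs-sum
    (fan-certified-dims k (suc n) d (entry weights) pairs 1≤k (s≤s z≤n) primal dual (trans weights-sum (sym pairs-sum)))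

split-∧ : ∀ {a b} → T (a ∧ b) → T a × T b
split-∧ = Equivalence.to T-∧

windowsᵇ : ℕ → ℕ → ℕ → List ℕ → Bool
windowsᵇ D τ p []                  = true
windowsᵇ D τ p (x ∷ [])            = τ ≤ᵇ p + x + 0
windowsᵇ D τ p (x ∷ y ∷ [])        = (τ ≤ᵇ p + x + y) ∧ (D ≤ᵇ p + x + y + 0) ∧ windowsᵇ D τ x (y ∷ [])
windowsᵇ D τ p (x ∷ y ∷ z ∷ [])    =
  (τ ≤ᵇ p + x + y) ∧ (D ≤ᵇ p + x + y + z) ∧ (D ≤ᵇ p + x + z + 0) ∧ windowsᵇ D τ x (y ∷ z ∷ [])
windowsᵇ D τ p (x ∷ y ∷ z ∷ w ∷ L) =
  (τ ≤ᵇ p + x + y) ∧ (D ≤ᵇ p + x + y + z) ∧ (D ≤ᵇ p + x + z + w) ∧ windowsᵇ D τ x (y ∷ z ∷ w ∷ L)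

windowsᵇ-sound : ∀ D τ p L → T (windowsᵇ D τ p L) → Windows D τ p L
windowsᵇ-sound D τ p []                  _ = tt
windowsᵇ-sound D τ p (x ∷ [])            w = ≤ᵇ⇒≤ _ _ w
windowsᵇ-sound D τ p (x ∷ y ∷ [])        w =
  let (w₁ , w′) = split-∧ w; (w₂ , W) = split-∧ w′
  in ≤ᵇ⇒≤ _ _ w₁ , ≤ᵇ⇒≤ _ _ w₂ , windowsᵇ-sound D τ x (y ∷ []) W
windowsᵇ-sound D τ p (x ∷ y ∷ z ∷ [])    w =
  let (w₁ , w′) = split-∧ w; (w₂ , w″) = split-∧ w′; (w₃ , W) = split-∧ w″
  in ≤ᵇ⇒≤ _ _ w₁ , ≤ᵇ⇒≤ _ _ w₂ , ≤ᵇ⇒≤ _ _ w₃ , windowsᵇ-sound D τ x (y ∷ z ∷ []) W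
windowsᵇ-sound D τ p (x ∷ y ∷ z ∷ v ∷ L) w =
  let (w₁ , w′) = split-∧ w; (w₂ , w″) = split-∧ w′; (w₃ , W) = split-∧ w″
  in ≤ᵇ⇒≤ _ _ w₁ , ≤ᵇ⇒≤ _ _ w₂ , ≤ᵇ⇒≤ _ _ w₃ , windowsᵇ-sound D τ x (y ∷ z ∷ v ∷ L) W

coverageᵇ : ℕ → ℕ → ℕ → ℕ → ℕ → ℕ → List ℕ → List ℕ → Bool
coverageᵇ D p₁ p₂ q₁ q₂ q₃ (x ∷ []) (y ∷ []) = 0 + x + p₁ + p₂ + (0 + y + q₂ + q₃) ≤ᵇ D
coverageᵇ D p₁ p₂ q₁ q₂ q₃ (x ∷ x′ ∷ L₁) (y ∷ y′ ∷ L₂) =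
  (x′ + x + p₁ + p₂ + (y′ + y + q₂ + q₃) ≤ᵇ D) ∧ coverageᵇ D x p₁ y q₁ q₂ (x′ ∷ L₁) (y′ ∷ L₂)
coverageᵇ D p₁ p₂ q₁ q₂ q₃ []            _             = true
coverageᵇ D p₁ p₂ q₁ q₂ q₃ (_ ∷ [])      []            = true
coverageᵇ D p₁ p₂ q₁ q₂ q₃ (_ ∷ [])      (_ ∷ _ ∷ _)   = true
coverageᵇ D p₁ p₂ q₁ q₂ q₃ (_ ∷ _ ∷ _)   []            = true
coverageᵇ D p₁ p₂ q₁ q₂ q₃ (_ ∷ _ ∷ _)   (_ ∷ [])      = true

coverageᵇ-sound : ∀ D p₁ p₂ q₁ q₂ q₃ L₁ L₂ → T (coverageᵇ D p₁ p₂ q₁ q₂ q₃ L₁ L₂) → Coverage D p₁ p₂ q₁ q₂ q₃ L₁ L₂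
coverageᵇ-sound D p₁ p₂ q₁ q₂ q₃ (x ∷ []) (y ∷ []) c = ≤ᵇ⇒≤ _ _ c
coverageᵇ-sound D p₁ p₂ q₁ q₂ q₃ (x ∷ x′ ∷ L₁) (y ∷ y′ ∷ L₂) c =
  let (c₁ , C) = split-∧ c in ≤ᵇ⇒≤ _ _ c₁ , coverageᵇ-sound D x p₁ y q₁ q₂ (x′ ∷ L₁) (y′ ∷ L₂) C
coverageᵇ-sound D p₁ p₂ q₁ q₂ q₃ []            _             _ = tt
coverageᵇ-sound D p₁ p₂ q₁ q₂ q₃ (_ ∷ [])      []            _ = tt
coverageᵇ-sound D p₁ p₂ q₁ q₂ q₃ (_ ∷ [])      (_ ∷ _ ∷ _)   _ = tt
coverageᵇ-sound D p₁ p₂ q₁ q₂ q₃ (_ ∷ _ ∷ _)   []            _ = tt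
coverageᵇ-sound D p₁ p₂ q₁ q₂ q₃ (_ ∷ _ ∷ _)   (_ ∷ [])      _ = tt

lastIsZeroᵇ : List ℕ → Bool
lastIsZeroᵇ []          = true
lastIsZeroᵇ (x ∷ [])    = x ≡ᵇ 0
lastIsZeroᵇ (x ∷ y ∷ L) = lastIsZeroᵇ (y ∷ L)

lastIsZeroᵇ-sound : ∀ L → T (lastIsZeroᵇ L) → LastIsZero L
lastIsZeroᵇ-sound []          _ = tt
lastIsZeroᵇ-sound (x ∷ [])    z = ≡ᵇ⇒≡ x 0 z
lastIsZeroᵇ-sound (x ∷ y ∷ L) z = lastIsZeroᵇ-sound (y ∷ L) z

penultimateIsZeroᵇ : List ℕ → Bool
penultimateIsZeroᵇ []              = true
penultimateIsZeroᵇ (x ∷ [])        = true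
penultimateIsZeroᵇ (x ∷ y ∷ [])    = x ≡ᵇ 0
penultimateIsZeroᵇ (x ∷ y ∷ z ∷ L) = penultimateIsZeroᵇ (y ∷ z ∷ L)

penultimateIsZeroᵇ-sound : ∀ L → T (penultimateIsZeroᵇ L) → PenultimateIsZero L
penultimateIsZeroᵇ-sound []              _ = tt
penultimateIsZeroᵇ-sound (x ∷ [])        _ = tt
penultimateIsZeroᵇ-sound (x ∷ y ∷ [])    z = ≡ᵇ⇒≡ x 0 z
penultimateIsZeroᵇ-sound (x ∷ y ∷ z ∷ L) p = penultimateIsZeroᵇ-sound (y ∷ z ∷ L) p

periodic : ℕ → List ℕ → List ℕ → List ℕ
periodic zero    B E = E
periodic (suc m) B E = B ++ periodic m B E

length-periodic : ∀ m B E → length (periodic m B E) ≡ m * length B + length E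
length-periodic zero    B E = refl
length-periodic (suc m) B E = trans (length-++ B) (trans (cong (λ t → length B + t) (length-periodic m B E))
  (sym (+-assoc (length B) (m * length B) (length E))))

sum-periodic : ∀ m B E → sum (periodic m B E) ≡ m * sum B + sum E
sum-periodic zero    B E = refl
sum-periodic (suc m) B E = trans (sum-++ B (periodic m B E)) (trans (cong (λ t → sum B + t) (sum-periodic m B E))
  (sym (+-assoc (sum B) (m * sum B) (sum E))))

-- A check that reads each block B the same way (B ends in the state it starts from) evaluates
-- on periodic (2 + m) B E to a conjunction of closed conditions and the check on periodic (1 + m) B E.
T-periodic : (check : ℕ → Bool) → T (check 1) → (∀ m → T (check (suc m)) → T (check (suc (suc m)))) →
  ∀ m → T (check (suc m))
T-periodic check base step zero    = base
T-periodic check base step (suc m) = step m (T-periodic check base step m)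

all-sound : ∀ {A : Set} {P : A → Set} (p : A → Bool) → (∀ x → T (p x) → P x) → ∀ L → T (all p L) → All P L
all-sound p sound []      _ = []
all-sound p sound (x ∷ L) b = let (px , pL) = split-∧ b in sound x px ∷ all-sound p sound L pL

dualᵇ : ℕ → List ℕ → List ℕ → Bool
dualᵇ D L₁ L₂ = lastIsZeroᵇ L₁ ∧ lastIsZeroᵇ L₂ ∧ penultimateIsZeroᵇ L₂ ∧ coverageᵇ D 0 0 0 0 0 L₁ L₂

certificatesᵇ : ∀ {n d} M τ (W L₁ L₂ : List ℕ) → length W ≡ n → length L₁ ≡ n → length L₂ ≡ n →
  T (windowsᵇ (suc d) τ 0 W) → T (all (_≤ᵇ M) W) → T (dualᵇ (suc d) L₁ L₂) →
  M ≤ suc d → suc d ≤ τ + τ → suc d + (M + M) ≤ sum W → sum W ≡ sum L₁ + sum L₂ → ListCertificates n d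
certificatesᵇ {d = d} M τ W L₁ L₂ lW l₁ l₂ windows W≤M dual M≤D D≤τ+τ apex sums =
  let (last₁ , dual′) = split-∧ dual; (last₂ , dual″) = split-∧ dual′; (pen₂ , covered) = split-∧ dual″
  in record
  { weights = W ; dual₁ = L₁ ; dual₂ = L₂ ; M = M ; τ = τ
  ; length-weights = lW ; length-dual₁ = l₁ ; length-dual₂ = l₂
  ; windows = windowsᵇ-sound (suc d) τ 0 W windows
  ; bounded = all-sound (_≤ᵇ M) (λ x → ≤ᵇ⇒≤ x M) W W≤M
  ; M≤D = M≤D ; D≤τ+τ = D≤τ+τ ; apex = apex
  ; dual₁-last = lastIsZeroᵇ-sound L₁ last₁
  ; dual₂-last = lastIsZeroᵇ-sound L₂ last₂
  ; dual₂-penultimate = penultimateIsZeroᵇ-sound L₂ pen₂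
  ; covered = coverageᵇ-sound (suc d) 0 0 0 0 0 L₁ L₂ covered
  ; sums = sums
  }

≤-by : ∀ {x y} t → x + t ≡ y → x ≤ y
≤-by {x} t x+t≡y = subst (x ≤_) x+t≡y (m≤m+n x t)

halfBlock pairBlock zeroBlock : List ℕ
halfBlock = 1 ∷ 0 ∷ 1 ∷ 0 ∷ []
pairBlock = 2 ∷ 0 ∷ 0 ∷ 0 ∷ []
zeroBlock = 0 ∷ 0 ∷ 0 ∷ 0 ∷ []

halfCertificates : ∀ {n} m m′ (E E₁ E₂ : List ℕ) →
  suc m * 4 + length E ≡ n → suc m′ * 4 + length E₁ ≡ n → suc m′ * 4 + length E₂ ≡ n →
  T (windowsᵇ 2 1 0 (periodic 1 halfBlock E)) → T (all (_≤ᵇ 1) (periodic 1 halfBlock E)) →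
  T (dualᵇ 2 (periodic 1 pairBlock E₁) (periodic 1 zeroBlock E₂)) →
  4 ≤ suc m * 2 + sum E → suc m * 2 + sum E ≡ suc m′ * 2 + sum E₁ + (suc m′ * 0 + sum E₂) →
  ListCertificates n 1
halfCertificates m m′ E E₁ E₂ lW l₁ l₂ windows bounded dual apex sums =
  certificatesᵇ 1 1 W L₁ L₂
    (trans (length-periodic (suc m) halfBlock E) lW)
    (trans (length-periodic (suc m′) pairBlock E₁) l₁)
    (trans (length-periodic (suc m′) zeroBlock E₂) l₂)
    (T-periodic (λ m → windowsᵇ 2 1 0 (periodic m halfBlock E)) windows (λ _ w → w) m)
    (T-periodic (λ m → all (_≤ᵇ 1) (periodic m halfBlock E)) bounded (λ _ b → b) m)
    (T-periodic (λ m → dualᵇ 2 (periodic m pairBlock E₁) (periodic m zeroBlock E₂)) dual (λ _ c → c) m′)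
    (s≤s z≤n) ≤-refl
    (subst (4 ≤_) (sym (sum-periodic (suc m) halfBlock E)) apex)
    (trans (sum-periodic (suc m) halfBlock E) (trans sums
      (sym (cong₂ _+_ (sum-periodic (suc m′) pairBlock E₁) (sum-periodic (suc m′) zeroBlock E₂)))))
  where
  W L₁ L₂ : List ℕ
  W  = periodic (suc m) halfBlock E
  L₁ = periodic (suc m′) pairBlock E₁
  L₂ = periodic (suc m′) zeroBlock E₂

certificates-4q+2 : ∀ m → ListCertificates (suc m * 4 + 2) 1
certificates-4q+2 m = halfCertificates m m (1 ∷ 1 ∷ []) (2 ∷ 0 ∷ []) (0 ∷ 0 ∷ []) refl refl refl _ _ _
  (s≤s (s≤s (m≤n+m 2 (m * 2)))) (sums m)
  where
  sums : ∀ m → suc m * 2 + 2 ≡ suc m * 2 + 2 + (suc m * 0 + 0)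
  sums = solve-∀

certificates-4q+3 : ∀ m → ListCertificates (suc m * 4 + 3) 1
certificates-4q+3 m = halfCertificates m m (1 ∷ 0 ∷ 1 ∷ []) (2 ∷ 0 ∷ 0 ∷ []) (0 ∷ 0 ∷ 0 ∷ []) refl refl refl _ _ _
  (s≤s (s≤s (m≤n+m 2 (m * 2)))) (sums m)
  where
  sums : ∀ m → suc m * 2 + 2 ≡ suc m * 2 + 2 + (suc m * 0 + 0)
  sums = solve-∀

-- For n = 4q + 1 the dual weight at the end of the path sits on pairs at distance two.
certificates-4q+1 : ∀ m → ListCertificates (suc (suc m) * 4 + 1) 1
certificates-4q+1 m = halfCertificates (suc m) m (1 ∷ []) (0 ∷ 0 ∷ 0 ∷ 0 ∷ 0 ∷ []) (1 ∷ 1 ∷ 1 ∷ 0 ∷ 0 ∷ [])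
  refl (lengths m) (lengths m) _ _ _ (s≤s (s≤s (s≤s (s≤s z≤n)))) (sums m)
  where
  lengths : ∀ m → suc m * 4 + 5 ≡ suc (suc m) * 4 + 1
  lengths = solve-∀
  sums : ∀ m → suc (suc m) * 2 + 1 ≡ suc m * 2 + 0 + (suc m * 0 + 3)
  sums = solve-∀

-- For n = 4m the weights of block i (i = j, m - 1 - i = k) are m - i, i + 1, m - i, i + 1, so
-- consecutive weights sum to τ = m + 1 and D = 2m + 1; the dual pairs at distance 1 carry
-- 2(m - i) - 1 and 2i + 1, those at distance 2 carry 1, 1, 0, 0 in every block. The separate tail
-- functions keep the head of the next block visible to the window bounds.
rampWeights rampTail : ℕ → ℕ → List ℕ
rampWeights j k = suc k ∷ suc j ∷ suc k ∷ suc j ∷ rampTail j k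
rampTail j zero    = []
rampTail j (suc k) = rampWeights (suc j) k

rampDual₁ rampDual₁Tail : ℕ → ℕ → List ℕ
rampDual₁ j k = suc (k + k) ∷ 0 ∷ suc (j + j) ∷ 0 ∷ rampDual₁Tail j k
rampDual₁Tail j zero    = []
rampDual₁Tail j (suc k) = rampDual₁ (suc j) k

rampBlock₂ : List ℕ
rampBlock₂ = 1 ∷ 1 ∷ 0 ∷ 0 ∷ []

-- List.[_] and List._∷_ keep the solver's variable lists unambiguous (All's constructors are in scope).
ramp-windows : ∀ k j s → j + k ≡ s → Windows (3 + (s + s)) (2 + s) j (rampWeights j k)
ramp-windows zero j .(j + 0) refl =
  ≤-by j (solve List.[ j ]) , ≤-by 0 (solve List.[ j ]) , ≤-by 0 (solve List.[ j ]) ,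
  ≤-by 1 (solve List.[ j ]) , ≤-by 1 (solve List.[ j ]) , ≤-by 0 (solve List.[ j ]) ,
  ≤-by (j + 1) (solve List.[ j ]) , ≤-by 0 (solve List.[ j ]) , ≤-by 0 (solve List.[ j ])
ramp-windows (suc k) j .(j + suc k) refl =
  ≤-by j (solve (j List.∷ List.[ k ])) , ≤-by 0 (solve (j List.∷ List.[ k ])) , ≤-by 0 (solve (j List.∷ List.[ k ])) ,
  ≤-by (k + 2) (solve (j List.∷ List.[ k ])) , ≤-by 1 (solve (j List.∷ List.[ k ])) , ≤-by 0 (solve (j List.∷ List.[ k ])) ,
  ≤-by (j + 1) (solve (j List.∷ List.[ k ])) , ≤-by 0 (solve (j List.∷ List.[ k ])) , ≤-by 1 (solve (j List.∷ List.[ k ])) ,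
  ≤-by (k + 1) (solve (j List.∷ List.[ k ])) , ≤-by 1 (solve (j List.∷ List.[ k ])) , ≤-by 1 (solve (j List.∷ List.[ k ])) ,
  ramp-windows k (suc j) (j + suc k) (sym (+-suc j k))

ramp-bounded : ∀ k j s → j + k ≡ s → All (_≤ 1 + s) (rampWeights j k)
ramp-bounded zero    j .(j + 0)     refl =
  ≤-by j (solve List.[ j ]) ∷ ≤-by 0 (solve List.[ j ]) ∷ ≤-by j (solve List.[ j ]) ∷ ≤-by 0 (solve List.[ j ]) ∷ []
ramp-bounded (suc k) j .(j + suc k) refl =
  ≤-by j (solve (j List.∷ List.[ k ])) ∷ ≤-by (k + 1) (solve (j List.∷ List.[ k ])) ∷
  ≤-by j (solve (j List.∷ List.[ k ])) ∷ ≤-by (k + 1) (solve (j List.∷ List.[ k ])) ∷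
  ramp-bounded k (suc j) (j + suc k) (sym (+-suc j k))

ramp-coverage : ∀ k j s → suc j + k ≡ s →
  Coverage (3 + (s + s)) 0 (suc (j + j)) 0 0 1 (rampDual₁ (suc j) k) (periodic (suc k) rampBlock₂ [])
ramp-coverage zero    j .(suc j + 0)     refl =
  ≤-reflexive (solve List.[ j ]) , ≤-reflexive (solve List.[ j ]) ,
  ≤-reflexive (solve List.[ j ]) , ≤-reflexive (solve List.[ j ])
ramp-coverage (suc k) j .(suc j + suc k) refl =
  ≤-reflexive (solve (j List.∷ List.[ k ])) , ≤-reflexive (solve (j List.∷ List.[ k ])) ,
  ≤-reflexive (solve (j List.∷ List.[ k ])) , ≤-reflexive (solve (j List.∷ List.[ k ])) ,
  ramp-coverage k (suc j) (suc j + suc k) (cong suc (sym (+-suc j k)))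

ramp-coverage-from-start : ∀ k →
  Coverage (3 + (suc k + suc k)) 0 0 0 0 0 (rampDual₁ 0 (suc k)) (periodic (suc (suc k)) rampBlock₂ [])
ramp-coverage-from-start k =
  ≤-reflexive (solve List.[ k ]) , ≤-reflexive (solve List.[ k ]) ,
  ≤-reflexive (solve List.[ k ]) , ≤-reflexive (solve List.[ k ]) ,
  ramp-coverage k 0 (suc k) refl

ramp-sum : ∀ j k → sum (rampWeights j k) ≡ suc k * ((2 + (j + k)) + (2 + (j + k)))
ramp-sum j zero    = last-block j
  where
  last-block : ∀ j → 1 + (suc j + (1 + (suc j + 0))) ≡ 1 * ((2 + (j + 0)) + (2 + (j + 0)))
  last-block = solve-∀
ramp-sum j (suc k) =
  trans (cong (λ t → suc (suc k) + (suc j + (suc (suc k) + (suc j + t)))) (ramp-sum (suc j) k)) (next-block j k)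
  where
  next-block : ∀ j k → suc (suc k) + (suc j + (suc (suc k) + (suc j + suc k * (2 + (suc j + k) + (2 + (suc j + k))))))
                       ≡ suc (suc k) * (2 + (j + suc k) + (2 + (j + suc k)))
  next-block = solve-∀

ramp-sums : ∀ j k → sum (rampWeights j k) ≡ sum (rampDual₁ j k) + sum (periodic (suc k) rampBlock₂ [])
ramp-sums j zero    = last-block j
  where
  last-block : ∀ j → 1 + (suc j + (1 + (suc j + 0))) ≡ 1 + (0 + (suc (j + j) + (0 + 0))) + (1 + (1 + (0 + (0 + 0))))
  last-block = solve-∀
ramp-sums j (suc k) =
  trans (cong (λ t → suc (suc k) + (suc j + (suc (suc k) + (suc j + t)))) (ramp-sums (suc j) k)) (next-block j k _ _)
  where
  next-block : ∀ j k x y → suc (suc k) + (suc j + (suc (suc k) + (suc j + (x + y))))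
                           ≡ suc (suc k + suc k) + (0 + (suc (j + j) + (0 + x))) + (1 + (1 + (0 + (0 + y))))
  next-block = solve-∀

length-rampWeights : ∀ j k → length (rampWeights j k) ≡ suc k * 4
length-rampWeights j zero    = refl
length-rampWeights j (suc k) = cong (λ t → 4 + t) (length-rampWeights (suc j) k)

length-rampDual₁ : ∀ j k → length (rampDual₁ j k) ≡ suc k * 4
length-rampDual₁ j zero    = refl
length-rampDual₁ j (suc k) = cong (λ t → 4 + t) (length-rampDual₁ (suc j) k)

rampDual₁-last : ∀ j k → LastIsZero (rampDual₁ j k)
rampDual₁-last j zero    = refl
rampDual₁-last j (suc k) = rampDual₁-last (suc j) k

rampBlock₂-last : ∀ k → T (lastIsZeroᵇ (periodic (suc k) rampBlock₂ []))
rampBlock₂-last = T-periodic (λ m → lastIsZeroᵇ (periodic m rampBlock₂ [])) _ (λ _ e → e)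

rampBlock₂-penultimate : ∀ k → T (penultimateIsZeroᵇ (periodic (suc k) rampBlock₂ []))
rampBlock₂-penultimate = T-periodic (λ m → penultimateIsZeroᵇ (periodic m rampBlock₂ [])) _ (λ _ e → e)

ramp-certificates : ∀ k → ListCertificates (suc (suc k) * 4) (2 + (suc k + suc k))
ramp-certificates k = record
  { weights = rampWeights 0 (suc k)
  ; dual₁ = rampDual₁ 0 (suc k)
  ; dual₂ = periodic (suc (suc k)) rampBlock₂ []
  ; M = 1 + suc k
  ; τ = 2 + suc k
  ; length-weights = length-rampWeights 0 (suc k)
  ; length-dual₁ = length-rampDual₁ 0 (suc k)
  ; length-dual₂ = trans (length-periodic (suc (suc k)) rampBlock₂ []) (+-identityʳ _)
  ; windows = ramp-windows (suc k) 0 (suc k) refl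
  ; bounded = ramp-bounded (suc k) 0 (suc k) refl
  ; M≤D = ≤-by (k + 3) (solve List.[ k ])
  ; D≤τ+τ = ≤-by 1 (solve List.[ k ])
  ; apex = ≤-by (2 * k * k + 6 * k + 3) (trans (apex-slack k) (sym (ramp-sum 0 (suc k))))
  ; dual₁-last = rampDual₁-last 0 (suc k)
  ; dual₂-last = lastIsZeroᵇ-sound (periodic (suc (suc k)) rampBlock₂ []) (rampBlock₂-last (suc k))
  ; dual₂-penultimate = penultimateIsZeroᵇ-sound (periodic (suc (suc k)) rampBlock₂ []) (rampBlock₂-penultimate (suc k))
  ; covered = ramp-coverage-from-start k
  ; sums = ramp-sums 0 (suc k)
  }
  where
  apex-slack : ∀ k → 3 + (suc k + suc k) + ((1 + suc k) + (1 + suc k)) + (2 * k * k + 6 * k + 3)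
                     ≡ suc (suc k) * ((2 + suc k) + (2 + suc k))
  apex-slack = solve-∀

dims-4q+2 : ∀ k m → 1 ≤ k → HasFracDims k (2 + suc m * 4) ((4 + suc m * 4) /1+ 3)
dims-4q+2 k m 1≤k = subst₂ (HasFracDims k) (+-comm (suc m * 4) 2) value dims
  where
  dims : HasFracDims k (suc m * 4 + 2) (sum (periodic (suc m) halfBlock (1 ∷ 1 ∷ [])) /1+ 1)
  dims = FromLists.dims 1≤k (certificates-4q+2 m)
  cross : ∀ m → (suc m * 2 + 2) * 4 ≡ (4 + suc m * 4) * 2
  cross = solve-∀
  value : sum (periodic (suc m) halfBlock (1 ∷ 1 ∷ [])) /1+ 1 ≡ (4 + suc m * 4) /1+ 3
  value = /1+-cross-≡ (sum (periodic (suc m) halfBlock (1 ∷ 1 ∷ []))) 1 (4 + suc m * 4) 3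
    (trans (cong (_* 4) (sum-periodic (suc m) halfBlock (1 ∷ 1 ∷ []))) (cross m))

dims-4q+3 : ∀ k m → 1 ≤ k → HasFracDims k (3 + suc m * 4) ((4 + suc m * 4) /1+ 3)
dims-4q+3 k m 1≤k = subst₂ (HasFracDims k) (+-comm (suc m * 4) 3) value dims
  where
  dims : HasFracDims k (suc m * 4 + 3) (sum (periodic (suc m) halfBlock (1 ∷ 0 ∷ 1 ∷ [])) /1+ 1)
  dims = FromLists.dims 1≤k (certificates-4q+3 m)
  cross : ∀ m → (suc m * 2 + 2) * 4 ≡ (4 + suc m * 4) * 2
  cross = solve-∀
  value : sum (periodic (suc m) halfBlock (1 ∷ 0 ∷ 1 ∷ [])) /1+ 1 ≡ (4 + suc m * 4) /1+ 3
  value = /1+-cross-≡ (sum (periodic (suc m) halfBlock (1 ∷ 0 ∷ 1 ∷ []))) 1 (4 + suc m * 4) 3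
    (trans (cong (_* 4) (sum-periodic (suc m) halfBlock (1 ∷ 0 ∷ 1 ∷ []))) (cross m))

dims-4q+1 : ∀ k m → 1 ≤ k → HasFracDims k (1 + suc (suc m) * 4) ((2 + suc (suc m) * 4) /1+ 3)
dims-4q+1 k m 1≤k = subst₂ (HasFracDims k) (+-comm (suc (suc m) * 4) 1) value dims
  where
  dims : HasFracDims k (suc (suc m) * 4 + 1) (sum (periodic (suc (suc m)) halfBlock (1 ∷ [])) /1+ 1)
  dims = FromLists.dims 1≤k (certificates-4q+1 m)
  cross : ∀ m → (suc (suc m) * 2 + 1) * 4 ≡ (2 + suc (suc m) * 4) * 2
  cross = solve-∀
  value : sum (periodic (suc (suc m)) halfBlock (1 ∷ [])) /1+ 1 ≡ (2 + suc (suc m) * 4) /1+ 3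
  value = /1+-cross-≡ (sum (periodic (suc (suc m)) halfBlock (1 ∷ []))) 1 (2 + suc (suc m) * 4) 3
    (trans (cong (_* 4) (sum-periodic (suc (suc m)) halfBlock (1 ∷ []))) (cross m))

rampValue : ℕ → ℚ
rampValue m = sum (rampWeights 0 (suc m)) /1+ (2 + (suc m + suc m))

dims-4q : ∀ k m → 1 ≤ k → HasFracDims k (suc (suc m) * 4) (rampValue m)
dims-4q k m 1≤k = FromLists.dims 1≤k (ramp-certificates m)

rampValue-lower : ∀ m → (suc (suc m) * 4) /1+ 3 ≤ℚ rampValue m
rampValue-lower m = /1+-cross-≤ (suc (suc m) * 4) 3 (sum (rampWeights 0 (suc m))) (2 + (suc m + suc m))
  (≤-by (4 * m + 8) (trans (cross m) (cong (_* 4) (sym (ramp-sum 0 (suc m))))))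
  where
  cross : ∀ m → suc (suc m) * 4 * (3 + (suc m + suc m)) + (4 * m + 8)
                ≡ suc (suc m) * ((2 + suc m) + (2 + suc m)) * 4
  cross = solve-∀

rampValue-upper : ∀ m → rampValue m ≤ℚ (2 + suc (suc m) * 4) /1+ 3
rampValue-upper m = /1+-cross-≤ (sum (rampWeights 0 (suc m))) (2 + (suc m + suc m)) (2 + suc (suc m) * 4) 3
  (≤-by 2 (trans (cong (λ t → t * 4 + 2) (ramp-sum 0 (suc m))) (cross m)))
  where
  cross : ∀ m → suc (suc m) * ((2 + suc m) + (2 + suc m)) * 4 + 2
                ≡ (2 + suc (suc m) * 4) * (3 + (suc m + suc m))
  cross = solve-∀

allUpTo : ℕ → (ℕ → Bool) → Bool
allUpTo zero    p = p 0
allUpTo (suc n) p = allUpTo n p ∧ p (suc n)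

allUpTo-sound : ∀ n p → T (allUpTo n p) → ∀ z → z ≤ n → T (p z)
allUpTo-sound zero    p h zero z≤n = h
allUpTo-sound (suc n) p h z z≤1+n with m≤n⇒m<n∨m≡n z≤1+n
... | inj₂ refl       = proj₂ (split-∧ h)
... | inj₁ (s≤s z≤n′) = allUpTo-sound n p (proj₁ (split-∧ h)) z z≤n′

primalCertificateᵇ : ℕ → ℕ → (ℕ → ℕ) → Bool
primalCertificateᵇ n d G =
  allUpTo n (λ z → G z ≤ᵇ suc d) ∧
  allUpTo n (λ a → allUpTo n (λ b → (a ≡ᵇ b) ∨ (suc d ≤ᵇ sumBelow (suc n) (λ z → ind (fanRes n a b z) (G z)))))

primalCertificateᵇ-sound : ∀ n d G → T (primalCertificateᵇ n d G) → IsPrimalCertificate (fanRes n) n d G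
primalCertificateᵇ-sound n d G check = bounded , resolves
  where
  bounded : ∀ z → z ≤ n → G z ≤ suc d
  bounded z z≤n′ = ≤ᵇ⇒≤ _ _ (allUpTo-sound n _ (proj₁ (split-∧ check)) z z≤n′)
  resolves : ∀ a b → a ≤ n → b ≤ n → a ≢ b → suc d ≤ sumBelow (suc n) (λ z → ind (fanRes n a b z) (G z))
  resolves a b a≤n b≤n a≢b
    with Equivalence.to T-∨ (allUpTo-sound n _ (allUpTo-sound n _ (proj₂ (split-∧ check)) a a≤n) b b≤n)
  ... | inj₁ a≡b      = ⊥-elim (a≢b (≡ᵇ⇒≡ a b a≡b))
  ... | inj₂ resolved = ≤ᵇ⇒≤ _ _ resolved

dualCertificateᵇ : ℕ → ℕ → List WeightedPair → Bool
dualCertificateᵇ n d L =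
  all (λ p → (left p ≤ᵇ n) ∧ (right p ≤ᵇ n) ∧ not (left p ≡ᵇ right p)) L ∧
  allUpTo n (λ z → coverage (fanRes n) L z ≤ᵇ suc d)

dualCertificateᵇ-sound : ∀ n d L → T (dualCertificateᵇ n d L) → IsDualCertificate (fanRes n) n d L
dualCertificateᵇ-sound n d L check =
  all-sound _ valid L (proj₁ (split-∧ check)) ,
  λ z z≤n′ → ≤ᵇ⇒≤ _ _ (allUpTo-sound n _ (proj₂ (split-∧ check)) z z≤n′)
  where
  valid : ∀ p → T ((left p ≤ᵇ n) ∧ (right p ≤ᵇ n) ∧ not (left p ≡ᵇ right p)) → IsValidPair n p
  valid p v = let (l , v′) = split-∧ v; (r , distinct) = split-∧ v′ in
    ≤ᵇ⇒≤ _ _ l , ≤ᵇ⇒≤ _ _ r , λ l≡r → subst (λ b → T (not b)) (≡⇒≡ᵇ-true l≡r) distinct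

small-dims : ∀ k n d (G : List ℕ) L → 1 ≤ k → 1 ≤ n → T (primalCertificateᵇ n d (entry G)) →
  T (dualCertificateᵇ n d L) → sumBelow (suc n) (entry G) ≡ totalWeight L → HasFracDims k n (totalWeight L /1+ d)
small-dims k n d G L 1≤k 1≤n primal dual sums = fan-certified-dims k n d (entry G) L 1≤k 1≤n
  (primalCertificateᵇ-sound n d (entry G) primal) (dualCertificateᵇ-sound n d L dual) sums

dims-1 : ∀ k → 1 ≤ k → HasFracDims k 1 (1 /1+ 0)
dims-1 k 1≤k = small-dims k 1 0 (1 ∷ 0 ∷ []) (wpair 1 0 1 ∷ []) 1≤k (s≤s z≤n) _ _ refl

dims-2 : ∀ k → 1 ≤ k → HasFracDims k 2 (3 /1+ 1)
dims-2 k 1≤k = small-dims k 2 1 (1 ∷ 1 ∷ 1 ∷ []) (wpair 1 0 1 ∷ wpair 1 0 2 ∷ wpair 1 1 2 ∷ []) 1≤k (s≤s z≤n) _ _ refl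

dims-3 : ∀ k → 1 ≤ k → HasFracDims k 3 (2 /1+ 0)
dims-3 k 1≤k = small-dims k 3 0 (1 ∷ 1 ∷ 0 ∷ 0 ∷ []) (wpair 1 0 2 ∷ wpair 1 1 3 ∷ []) 1≤k (s≤s z≤n) _ _ refl

dims-4 : ∀ k → 1 ≤ k → HasFracDims k 4 (5 /1+ 2)
dims-4 k 1≤k = small-dims k 4 2 (1 ∷ 1 ∷ 1 ∷ 1 ∷ 1 ∷ [])
  (wpair 1 0 1 ∷ wpair 1 0 2 ∷ wpair 2 1 4 ∷ wpair 1 2 4 ∷ []) 1≤k (s≤s z≤n) _ _ refl

dims-5 : ∀ k → 1 ≤ k → HasFracDims k 5 (10 /1+ 5)
dims-5 k 1≤k = small-dims k 5 5 (1 ∷ 2 ∷ 3 ∷ 2 ∷ 1 ∷ 1 ∷ [])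
  (wpair 2 0 1 ∷ wpair 2 0 2 ∷ wpair 4 1 5 ∷ wpair 2 2 5 ∷ []) 1≤k (s≤s z≤n) _ _ refl

PaperValue : ℕ → ℚ → Set
PaperValue n v =
  (n ≤ 3 → v ≡ + (suc n) / 2) × ((n ≡ 4 ⊎ n ≡ 5) → v ≡ + 5 / 3) ×
  (6 ≤ n → (n % 4 ≡ 1 ⊎ n % 4 ≡ 3) → v ≡ + (suc n) / 4) × (6 ≤ n → n % 4 ≡ 2 → v ≡ + (suc (suc n)) / 4)

PartA : ℕ → ℕ → Set
PartA k n = Σ ℚ (λ v → IsTruncFracMetricDim k (fan n) v × IsFracMetricDim (fan n) v × PaperValue n v)

PartB : ℕ → ℕ → Set
PartB k n = Σ ℚ (λ v → IsTruncFracMetricDim k (fan n) v × IsFracMetricDim (fan n) v ×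
                       (+ n / 4 ≤ℚ v) × (v ≤ℚ + (suc (suc n)) / 4))

opaque
  unfolding HasFracDims

  with-value : ∀ {k n v} → HasFracDims k n v → PaperValue n v → PartA k n
  with-value {v = v} (trunc , frac) value = v , trunc , frac , value

  with-bounds : ∀ {k n v} → HasFracDims k n v → n /1+ 3 ≤ℚ v → v ≤ℚ suc (suc n) /1+ 3 → PartB k n
  with-bounds {n = n} {v} (trunc , frac) lower upper =
    v , trunc , frac , subst (_≤ℚ v) (/1+-def n 3) lower , subst (v ≤ℚ_) (/1+-def (suc (suc n)) 3) upper

small-value : ∀ {n v} → n ≤ 5 → (n ≤ 3 → v ≡ + (suc n) / 2) → ((n ≡ 4 ⊎ n ≡ 5) → v ≡ + 5 / 3) → PaperValue n v
small-value n≤5 low middle = low , middle , (λ 6≤n → ⊥-elim (<⇒≱ (s≤s n≤5) 6≤n)) , (λ 6≤n → ⊥-elim (<⇒≱ (s≤s n≤5) 6≤n))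

large-value : ∀ {n v} → 6 ≤ n → ((n % 4 ≡ 1 ⊎ n % 4 ≡ 3) → v ≡ + (suc n) / 4) → (n % 4 ≡ 2 → v ≡ + (suc (suc n)) / 4) →
  PaperValue n v
large-value 6≤n odd two =
  (λ n≤3 → ⊥-elim (<⇒≱ (≤-trans (s≤s (s≤s (s≤s (s≤s z≤n)))) 6≤n) n≤3)) ,
  (λ { (inj₁ n≡4) → ⊥-elim (<⇒≢ (≤-trans (n≤1+n 5) 6≤n) (sym n≡4))
     ; (inj₂ n≡5) → ⊥-elim (<⇒≢ 6≤n (sym n≡5)) }) ,
  (λ _ → odd) , (λ _ → two)

residue : ∀ r q → (r + q * 4) % 4 ≡ r % 4
residue r q = [m+kn]%n≡m%n r q 4

residue-mismatch : ∀ {A : Set} r q {s} → r % 4 ≢ s → (r + q * 4) % 4 ≡ s → A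
residue-mismatch r q r≢s e = ⊥-elim (r≢s (trans (sym (residue r q)) e))

partA-1 : ∀ k → 1 ≤ k → PartA k 1
partA-1 k 1≤k = with-value (dims-1 k 1≤k)
  (small-value (s≤s z≤n) (λ _ → trans (/1+-cross-≡ 1 0 2 1 refl) (/1+-def 2 1)) (λ { (inj₁ ()) ; (inj₂ ()) }))

partA-2 : ∀ k → 1 ≤ k → PartA k 2
partA-2 k 1≤k = with-value (dims-2 k 1≤k)
  (small-value (s≤s (s≤s z≤n)) (λ _ → /1+-def 3 1) (λ { (inj₁ ()) ; (inj₂ ()) }))

partA-3 : ∀ k → 1 ≤ k → PartA k 3
partA-3 k 1≤k = with-value (dims-3 k 1≤k)
  (small-value (s≤s (s≤s (s≤s z≤n))) (λ _ → trans (/1+-cross-≡ 2 0 4 1 refl) (/1+-def 4 1)) (λ { (inj₁ ()) ; (inj₂ ()) }))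

partA-4 : ∀ k → 1 ≤ k → PartA k 4
partA-4 k 1≤k = with-value (dims-4 k 1≤k)
  (small-value (s≤s (s≤s (s≤s (s≤s z≤n)))) (λ { (s≤s (s≤s (s≤s ()))) }) (λ _ → /1+-def 5 2))

partA-5 : ∀ k → 1 ≤ k → PartA k 5
partA-5 k 1≤k = with-value (dims-5 k 1≤k)
  (small-value ≤-refl (λ { (s≤s (s≤s (s≤s ()))) }) (λ _ → trans (/1+-cross-≡ 10 5 5 2 refl) (/1+-def 5 2)))

partA-4q : ∀ k m → 1 ≤ k → PartA k (suc (suc m) * 4)
partA-4q k m 1≤k = with-value (dims-4q k m 1≤k) (large-value (m≤m+n 6 (2 + m * 4))
  (λ { (inj₁ e) → residue-mismatch 0 (suc (suc m)) (λ ()) e ; (inj₂ e) → residue-mismatch 0 (suc (suc m)) (λ ()) e })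
  (residue-mismatch 0 (suc (suc m)) (λ ())))

partA-4q+1 : ∀ k m → 1 ≤ k → PartA k (1 + suc (suc m) * 4)
partA-4q+1 k m 1≤k = with-value (dims-4q+1 k m 1≤k) (large-value (m≤m+n 6 (3 + m * 4))
  (λ _ → /1+-def (2 + suc (suc m) * 4) 3) (residue-mismatch 1 (suc (suc m)) (λ ())))

partA-4q+2 : ∀ k m → 1 ≤ k → PartA k (2 + suc m * 4)
partA-4q+2 k m 1≤k = with-value (dims-4q+2 k m 1≤k) (large-value (m≤m+n 6 (m * 4))
  (λ { (inj₁ e) → residue-mismatch 2 (suc m) (λ ()) e ; (inj₂ e) → residue-mismatch 2 (suc m) (λ ()) e })
  (λ _ → /1+-def (4 + suc m * 4) 3))

partA-4q+3 : ∀ k m → 1 ≤ k → PartA k (3 + suc m * 4)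
partA-4q+3 k m 1≤k = with-value (dims-4q+3 k m 1≤k) (large-value (m≤m+n 6 (1 + m * 4))
  (λ _ → /1+-def (4 + suc m * 4) 3) (residue-mismatch 3 (suc m) (λ ())))

-- Transport along an index equation without unfolding the fan (the index is fixed first).
move : ∀ {P : ℕ → Set} {m n} → P m → m ≡ n → P n
move p refl = p

partA : ∀ k → 1 ≤ k → ∀ n → 1 ≤ n → PartA k n
partA k 1≤k n 1≤n = by-residue (n % 4) (n ℕ./ 4) (m%n<n n 4) (m≡m%n+[m/n]*n n 4)
  where
  by-residue : ∀ r q → r < 4 → n ≡ r + q * 4 → PartA k n
  by-residue 0 0             _ n≡0 = ⊥-elim (<⇒≢ 1≤n (sym n≡0))
  by-residue 1 0             _ n≡r = move {PartA k} {1} (partA-1 k 1≤k) (sym n≡r)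
  by-residue 2 0             _ n≡r = move {PartA k} {2} (partA-2 k 1≤k) (sym n≡r)
  by-residue 3 0             _ n≡r = move {PartA k} {3} (partA-3 k 1≤k) (sym n≡r)
  by-residue 0 1             _ n≡4 = move {PartA k} {4} (partA-4 k 1≤k) (sym n≡4)
  by-residue 1 1             _ n≡5 = move {PartA k} {5} (partA-5 k 1≤k) (sym n≡5)
  by-residue 0 (suc (suc m)) _ n≡4q = move {PartA k} {suc (suc m) * 4} (partA-4q k m 1≤k) (sym n≡4q)
  by-residue 1 (suc (suc m)) _ n≡4q+1 = move {PartA k} {1 + suc (suc m) * 4} (partA-4q+1 k m 1≤k) (sym n≡4q+1)
  by-residue 2 (suc m)       _ n≡4q+2 = move {PartA k} {2 + suc m * 4} (partA-4q+2 k m 1≤k) (sym n≡4q+2)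
  by-residue 3 (suc m)       _ n≡4q+3 = move {PartA k} {3 + suc m * 4} (partA-4q+3 k m 1≤k) (sym n≡4q+3)
  by-residue (suc (suc (suc (suc r)))) _ (s≤s (s≤s (s≤s (s≤s ())))) _

partB : ∀ k → 1 ≤ k → ∀ n → 8 ≤ n → n % 4 ≡ 0 → PartB k n
partB k 1≤k n 8≤n n%4≡0 = by-quotient (n ℕ./ 4) (trans (m≡m%n+[m/n]*n n 4) (cong (λ r → r + (n ℕ./ 4) * 4) n%4≡0))
  where
  by-quotient : ∀ q → n ≡ 0 + q * 4 → PartB k n
  by-quotient 0 n≡0 = ⊥-elim (<⇒≢ (≤-trans (s≤s z≤n) 8≤n) (sym n≡0))
  by-quotient 1 n≡4 with subst (8 ≤_) n≡4 8≤n
  ... | s≤s (s≤s (s≤s (s≤s ())))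
  by-quotient (suc (suc m)) n≡4q =
    move {PartB k} {suc (suc m) * 4} (with-bounds (dims-4q k m 1≤k) (rampValue-lower m) (rampValue-upper m)) (sym n≡4q)

theorem3p3 : (k : ℕ) → 1 ≤ k →
    ((n : ℕ) → 1 ≤ n →
      Σ ℚ (λ d →
        IsTruncFracMetricDim k (fan n) d × IsFracMetricDim (fan n) d ×
        ((n ≤ 3 → d ≡ + (suc n) / 2) ×
         ((n ≡ 4 ⊎ n ≡ 5) → d ≡ + 5 / 3) ×
         (6 ≤ n → (n % 4 ≡ 1 ⊎ n % 4 ≡ 3) → d ≡ + (suc n) / 4) ×
         (6 ≤ n → n % 4 ≡ 2 → d ≡ + (suc (suc n)) / 4)))) ×
    ((n : ℕ) → 8 ≤ n → n % 4 ≡ 0 →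
      Σ ℚ (λ d →
        IsTruncFracMetricDim k (fan n) d × IsFracMetricDim (fan n) d ×
        (+ n / 4 ≤ℚ d) × (d ≤ℚ + (suc (suc n)) / 4)))
theorem3p3 k 1≤k = partA k 1≤k , partB k 1≤k
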